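{- Let $r\ge3$ and $1<s\le r$ be integers, let $a_1,\dots,a_r\in\Omega$ be defined recursively by $a_1=(a_r,\mathrm{id})\sigma$, $a_i=(\mathrm{id},a_{i-1})$ for $2\le i\le s-1$, $a_s=(\mathrm{id},a_{s-1})\sigma$, $a_i=(a_{i-1},\mathrm{id})$ for $s+1\le i\le r$, and let $G$ be the closed subgroup of $\Omega$ topologically generated by $a_1,\dots,a_r$. For $i\in\{1,\dots,r\}$ let $N_i$ be the topological closure of the subgroup of $G$ generated by all $G$-conjugates of the elements $a_j$ with $j\not\equiv i$ and $j\not\equiv i-s+1\pmod r$. Then for every $i\in\{1,\dots,r\}$, the quotient $G/N_i$ is isomorphic to the additive group of $2$-adic integers $\mathbb{Z}_2$.
   Context: $T$ is the regular rooted binary tree whose vertices are finite words over $\{0,1\}$; $\Omega=\mathrm{Aut}(T)$ with its profinite topology; automorphisms act on the right and $\gamma\gamma'$ means first $\gamma$ then $\gamma'$. Every $\gamma\in\Omega$ is written uniquely as $(\gamma_0,\gamma_1)\tau$ with $\tau\in\{\mathrm{id},\sigma\}$, meaning $(xv)\gamma=(x)\tau\,(v)\gamma_x$ for a letter $x$ and word $v$; $\sigma=(\mathrm{id},\mathrm{id})\sigma$ swaps the first letter. Multiplication: $(\gamma_0,\gamma_1)\tau\cdot(\gamma_0',\gamma_1')\tau'=(\gamma_0\gamma'_{(0)\tau},\gamma_1\gamma'_{(1)\tau})\tau\tau'$. Indices of the $a_j$ are taken modulo $r$ in $\{1,\dots,r\}$. -}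

module Defs where

open import Data.Bool using (Bool; true; false; if_then_else_; _xor_; _∨_)
open import Data.Nat using (ℕ; zero; suc; _+_; _*_; _∸_; _^_; _<_; _%_; _≡ᵇ_; _<ᵇ_)
open import Data.List using (List; []; _∷_; length)
open import Data.List.Relation.Unary.All using (All)
open import Data.Product using (Σ; ∃; _×_; _,_; proj₁)
open import Data.Sum using (_⊎_)
open import Relation.Nullary using (¬_)
open import Relation.Binary.PropositionalEquality using (_≡_)

-- Every γ ∈ Aut(T) is uniquely (γ₀,γ₁)τ; recursively,
-- γ is determined by the labels τ_v ∈ {id,σ} (true = σ) of its sections γ_v
-- at all vertices v.

Word : Set
Word = List Bool

Aut : Set
Aut = Word → Bool

sect : Aut → Bool → Aut
sect p x w = p (x ∷ w)

act : Aut → Word → Word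
act p [] = []
act p (x ∷ v) = (x xor p []) ∷ act (sect p x) v

actInv : Aut → Word → Word
actInv p [] = []
actInv p (x ∷ v) = (x xor p []) ∷ actInv (sect p (x xor p [])) v

idA : Aut
idA _ = false

-- γγ' : first γ then γ'; its label at v is τ_v(γ) xor τ_{(v)γ}(γ')
_·_ : Aut → Aut → Aut
(p · q) v = p v xor q (act p v)

inv : Aut → Aut
inv p v = p (actInv p v)

conj : Aut → Aut → Aut
conj g h = (inv h · g) · h

_≈A_ : Aut → Aut → Set
p ≈A q = ∀ v → p v ≡ q v

-- agreement on all vertices of length < n (i.e. same image in Aut(T/level n));
-- these define the profinite topology
AgreeBelow : ℕ → Aut → Aut → Set
AgreeBelow n p q = ∀ v → length v < n → p v ≡ q v

-- The generators a_i (i ∈ {1..r}), for parameters r, s.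
--  a_1 = (a_r, id)σ ; a_i = (id, a_{i-1}) for 2 ≤ i ≤ s-1 ;
--  a_s = (id, a_{s-1})σ ; a_i = (a_{i-1}, id) for s+1 ≤ i ≤ r.
-- (false = letter 0, true = letter 1.)  Indices outside 1..r never occur.

gen : ℕ → ℕ → ℕ → Aut
gen r s i [] = (i ≡ᵇ 1) ∨ (i ≡ᵇ s)
gen r s i (b ∷ w) =
  if i ≡ᵇ 1 then (if b then false else gen r s r w)
  else if (i <ᵇ s) ∨ (i ≡ᵇ s) then (if b then gen r s (i ∸ 1) w else false)
  else (if b then false else gen r s (i ∸ 1) w)

-- evaluating a product of letters (x, e) with x ∈ Aut and e = true meaning x⁻¹
evalWord : List (Aut × Bool) → Aut
evalWord [] = idA
evalWord ((x , e) ∷ ws) = (if e then inv x else x) · evalWord ws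

InRange : ℕ → ℕ → Set
InRange r j = (1 Data.Nat.≤ j) × (j Data.Nat.≤ r)

-- G = closure of ⟨a_1,…,a_r⟩ : at every level n, γ agrees with some
-- finite product of the a_j^{±1}
InG : ℕ → ℕ → Aut → Set
InG r s γ = ∀ n → ∃ λ (ws : List (ℕ × Bool)) →
  All (λ { (j , e) → InRange r j }) ws ×
  AgreeBelow n (evalWord (Data.List.map (λ { (j , e) → (gen r s j , e) }) ws)) γ

-- representative in {1..r} of i - s + 1 modulo r
shiftIdx : ℕ → ℕ → ℕ → ℕ
shiftIdx r s i = suc ((i + r ∸ s) % suc (r ∸ 1))

Allowed : ℕ → ℕ → ℕ → ℕ → Set
Allowed r s i j = InRange r j × ¬ (j ≡ i) × ¬ (j ≡ shiftIdx r s i)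

-- N_i = closure of the subgroup generated by the G-conjugates a_j^h
-- (h ∈ G, j allowed): at every level n, γ agrees with a finite product of
-- such conjugates and their inverses
InN : ℕ → ℕ → ℕ → Aut → Set
InN r s i γ = ∀ n → ∃ λ (ws : List (Aut × ℕ × Bool)) →
  All (λ { (h , j , e) → InG r s h × Allowed r s i j }) ws ×
  AgreeBelow n (evalWord (Data.List.map (λ { (h , j , e) → (conj (gen r s j) h , e) }) ws)) γ

-- 2-adic integers as the inverse limit of ℤ/2ⁿ : compatible residues

record ℤ₂ : Set where
  field
    res    : ℕ → ℕ
    res<   : ∀ n → res n < 2 ^ n
    compat : ∀ n → (res (suc n) ≡ res n) ⊎ (res (suc n) ≡ res n + 2 ^ n)
open ℤ₂ public

_≈₂_ : ℤ₂ → ℤ₂ → Set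
x ≈₂ y = ∀ n → res x n ≡ res y n

-- z ≈ x + y in ℤ₂ (addition is levelwise mod 2ⁿ)
IsSum : ℤ₂ → ℤ₂ → ℤ₂ → Set
IsSum z x y = ∀ n → (res x n + res y n ≡ res z n) ⊎ (res x n + res y n ≡ res z n + 2 ^ n)

IsZero : ℤ₂ → Set
IsZero x = ∀ n → res x n ≡ 0

GElt : ℕ → ℕ → Set
GElt r s = Σ Aut (InG r s)

-- G/N_i ≅ ℤ₂ as topological groups, expressed (no quotient types) as: a
-- well-defined continuous surjective homomorphism φ : G → ℤ₂ with kernel N_i.
QuotientIsoℤ₂ : ℕ → ℕ → ℕ → Set
QuotientIsoℤ₂ r s i = Σ (GElt r s → ℤ₂) λ φ →
    (∀ g h → proj₁ g ≈A proj₁ h → φ g ≈₂ φ h)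
  × (∀ n → ∃ λ m → ∀ g h → AgreeBelow m (proj₁ g) (proj₁ h) → res (φ g) n ≡ res (φ h) n)
  × (∀ g h k → proj₁ k ≈A (proj₁ g · proj₁ h) → IsSum (φ k) (φ g) (φ h))
  × (∀ z → ∃ λ g → φ g ≈₂ z)
  × (∀ g → IsZero (φ g) → InN r s i (proj₁ g))
  × (∀ g → InN r s i (proj₁ g) → IsZero (φ g))

{-# OPTIONS --safe #-}
-- Modulo N_i all generators except x = a_i and y = a_{i′}, i′ ≡ i − s + 1, die, and the relation
-- a₁a₂⋯a_r = 1 becomes xy = 1; so G/N_i is generated by x, and the isomorphism to ℤ₂ sends a word to
-- its weight, the exponent sum of x minus that of y. This weight can be read off the automorphism
-- itself, to any 2-adic precision, from finitely many levels. Passing to the two first-level sections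
-- shifts every index down by one (cyclically) and preserves the weight summed over both sections, so
-- after d levels, d ≡ i − s, the (i, i′)-weight becomes the (s, 1)-weight. Since a₁ and a_s are the only
-- rooted generators, the (s, 1)-weight is the parity bit at the root plus twice the (s − 1, r)-weight of
-- the 0-section, which r − 1 levels further down is again an (s, 1)-weight. Hence the weight extends
-- continuously to the closure G, and its kernel is the closure of N_i because x^{2ⁿ} is trivial on the
-- first n levels.

module Submission where

open import Defs
open import Algebra.Bundles using (Group)
import Algebra.Properties.Group as GroupProperties
open import Data.Bool using (Bool; true; false; if_then_else_; _xor_; not; _∨_)
open import Data.Bool.Properties
  using (xor-assoc; xor-comm; xor-same; xor-identityʳ; T-≡; ¬-not; if-eta; ∨-conicalˡ; ∨-conicalʳ; ∨-zeroʳ)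
open import Data.Empty using (⊥-elim)
open import Data.Integer using (ℤ; +_; -[1+_]; 0ℤ; 1ℤ; -1ℤ; _+_; _-_; -_; _*_; ∣_∣)
import Data.Integer.Properties as ℤ
open import Data.Integer.Tactic.RingSolver using (solve-∀)
open import Algebra.Properties.CommutativeSemigroup ℤ.+-commutativeSemigroup using (interchange)
open import Data.List using (List; []; _∷_; length; _++_; map; replicate)
open import Data.List.Properties using (map-++; length-++; ++-assoc)
open import Data.List.Relation.Unary.All using (All; []; _∷_)
import Data.List.Relation.Unary.All.Properties as All
open import Data.Nat
  using (ℕ; zero; suc; _≤_; _<_; s≤s; z≤n; _∸_; _^_; _%_; _/_; _≡ᵇ_; _<ᵇ_; _≟_; _<?_; NonZero; >-nonZero)
  renaming (_+_ to _+ℕ_; _*_ to _*ℕ_)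
open import Data.Nat.Divisibility using (divides)
open import Data.Nat.DivMod
  using ( [m+kn]%n≡m%n; [m+n]%n≡m%n; m<n⇒m%n≡m; m%n<n; m≤n⇒[n∸m]%m≡n%m; m∣n⇒o%n%m≡o%m
        ; %-distribˡ-+; m≡m%n+[m/n]*n )
open import Data.Nat.Properties
  using ( ≤-refl; ≤-trans; <-trans; <-≤-trans; <⇒≤; ≤-pred; n<1+n; n≤1+n; n≮n; ≮⇒≥; ≰⇒>; <⇒≱; ≤∧≢⇒<
        ; _≤?_; <-cmp
        ; ≡ᵇ⇒≡; ≡⇒≡ᵇ; <⇒<ᵇ; <ᵇ⇒<
        ; +-comm; +-assoc; +-identityʳ; +-suc; +-cancelˡ-≡; *-comm; *-assoc; *-suc; *-zeroʳ; *-distribˡ-+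
        ; +-mono-<; +-monoˡ-<; +-monoʳ-<; +-monoʳ-≤; *-monoʳ-≤; m≤m+n; m≤n+m; m<m+n; m≤n*m
        ; +-∸-comm; +-∸-assoc; m+n∸n≡m; m∸n+n≡m; m+[n∸m]≡n; m∸[m∸n]≡n; ∸-monoˡ-<; ∸-monoʳ-<
        ; ^-distribˡ-+-*; m^n≢0; m^n>0 )
open import Data.Product using (∃; _×_; _,_; proj₁; proj₂)
open import Data.Sum using (_⊎_; inj₁; inj₂)
import Data.Sum as Sum
open import Function.Base using (_∘_)
open import Function.Bundles using (Equivalence)
open import Relation.Binary.Bundles using (Setoid; Preorder)
open import Relation.Binary.Definitions using (tri<; tri≈; tri>)
open import Relation.Binary.PropositionalEquality
  using (_≡_; _≢_; refl; sym; trans; cong; cong₂; subst; subst₂; module ≡-Reasoning)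
import Relation.Binary.Reasoning.Preorder as PreorderReasoning
import Relation.Binary.Reasoning.Setoid as SetoidReasoning
open import Relation.Binary.Structures using (IsEquivalence)
open import Relation.Nullary using (yes; no)

-- Automorphisms of the binary tree

≈A-isEquivalence : IsEquivalence _≈A_
≈A-isEquivalence = record
  { refl = λ _ → refl ; sym = λ e v → sym (e v) ; trans = λ e f v → trans (e v) (f v) }

Aut-setoid : Setoid _ _
Aut-setoid = record { isEquivalence = ≈A-isEquivalence }

open IsEquivalence ≈A-isEquivalence public
  using () renaming (refl to ≈A-refl; sym to ≈A-sym; trans to ≈A-trans)

xor-cancelʳ : ∀ x y → (x xor y) xor y ≡ x
xor-cancelʳ x y = trans (xor-assoc x y y) (trans (cong (x xor_) (xor-same y)) (xor-identityʳ x))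

xor-rotate : ∀ x y z → x xor (y xor z) ≡ (x xor z) xor y
xor-rotate x y z = trans (cong (x xor_) (xor-comm y z)) (sym (xor-assoc x z y))

length-act : ∀ p v → length (act p v) ≡ length v
length-act p [] = refl
length-act p (x ∷ v) = cong suc (length-act (sect p x) v)

length-actInv : ∀ p v → length (actInv p v) ≡ length v
length-actInv p [] = refl
length-actInv p (x ∷ v) = cong suc (length-actInv _ v)

act-· : ∀ p q v → act (p · q) v ≡ act q (act p v)
act-· p q [] = refl
act-· p q (x ∷ v) =
  cong₂ _∷_ (sym (xor-assoc x (p []) (q []))) (act-· (sect p x) (sect q (x xor p [])) v)

act-idA : ∀ v → act idA v ≡ v
act-idA [] = refl
act-idA (x ∷ v) = cong₂ _∷_ (xor-identityʳ x) (act-idA v)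

act-inv : ∀ p v → act (inv p) v ≡ actInv p v
act-inv p [] = refl
act-inv p (x ∷ v) = cong ((x xor p []) ∷_) (act-inv (sect p (x xor p [])) v)

actInv-act : ∀ p v → actInv p (act p v) ≡ v
actInv-act p [] = refl
actInv-act p (x ∷ v) =
  cong₂ _∷_ (xor-cancelʳ x (p []))
    (trans (cong (λ y → actInv (sect p y) (act (sect p x) v)) (xor-cancelʳ x (p []))) (actInv-act (sect p x) v))

module _ {n : ℕ} where

  agree-refl : ∀ {p} → AgreeBelow n p p
  agree-refl _ _ = refl

  agree-trans : ∀ {p q t} → AgreeBelow n p q → AgreeBelow n q t → AgreeBelow n p t
  agree-trans a b v l = trans (a v l) (b v l)

≈⇒agree : ∀ {n p q} → p ≈A q → AgreeBelow n p q
≈⇒agree e v _ = e v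

agree-weaken : ∀ {m n p q} → m ≤ n → AgreeBelow n p q → AgreeBelow m p q
agree-weaken m≤n a v l = a v (<-≤-trans l m≤n)

sect-agree : ∀ {n p q} x → AgreeBelow (suc n) p q → AgreeBelow n (sect p x) (sect q x)
sect-agree x a w l = a (x ∷ w) (s≤s l)

act-agree : ∀ {n p q} v → AgreeBelow n p q → length v ≤ n → act p v ≡ act q v
act-agree [] a l = refl
act-agree {suc n} (x ∷ v) a (s≤s l) =
  cong₂ _∷_ (cong (x xor_) (a [] (s≤s z≤n))) (act-agree v (sect-agree x a) l)

actInv-agree : ∀ {n p q} v → AgreeBelow n p q → length v ≤ n → actInv p v ≡ actInv q v
actInv-agree [] a l = refl
actInv-agree {suc n} {p} {q} (x ∷ v) a (s≤s l) rewrite a [] (s≤s z≤n) =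
  cong ((x xor q []) ∷_) (actInv-agree v (sect-agree (x xor q []) a) l)

agree-· : ∀ {n p p′ q q′} → AgreeBelow n p p′ → AgreeBelow n q q′ → AgreeBelow n (p · q) (p′ · q′)
agree-· {p′ = p′} {q = q} a b v l = cong₂ _xor_ (a v l)
  (trans (cong q (act-agree v a (<⇒≤ l))) (b (act p′ v) (subst (_< _) (sym (length-act p′ v)) l)))

agree-inv : ∀ {n p q} → AgreeBelow n p q → AgreeBelow n (inv p) (inv q)
agree-inv {p = p} {q} a v l = trans (cong p (actInv-agree v a (<⇒≤ l)))
  (a (actInv q v) (subst (_< _) (sym (length-actInv q v)) l))

·-cong : ∀ {p p′ q q′} → p ≈A p′ → q ≈A q′ → (p · q) ≈A (p′ · q′)
·-cong e f v = agree-· {suc (length v)} (≈⇒agree e) (≈⇒agree f) v ≤-refl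

inv-cong : ∀ {p q} → p ≈A q → inv p ≈A inv q
inv-cong e v = agree-inv {suc (length v)} (≈⇒agree e) v ≤-refl

·-assoc : ∀ p q t → ((p · q) · t) ≈A (p · (q · t))
·-assoc p q t v =
  trans (xor-assoc (p v) _ _) (cong (λ w → p v xor (q (act p v) xor t w)) (act-· p q v))

Aut-group : Group _ _
Aut-group = record
  { Carrier = Aut ; _≈_ = _≈A_ ; _∙_ = _·_ ; ε = idA ; _⁻¹ = inv
  ; isGroup = record
    { isMonoid = record
      { isSemigroup = record
        { isMagma = record { isEquivalence = ≈A-isEquivalence ; ∙-cong = ·-cong }
        ; assoc = ·-assoc }
      ; identity = (λ p v → cong p (act-idA v)) , (λ p v → xor-identityʳ (p v)) }
    ; inverse = (λ p v → trans (cong (λ w → p (actInv p v) xor p w) (act-inv p v)) (xor-same (p (actInv p v))))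
              , (λ p v → trans (cong (λ w → p v xor p w) (actInv-act p v)) (xor-same (p v)))
    ; ⁻¹-cong = inv-cong } }

open Group Aut-group public using (identityˡ; identityʳ; inverseˡ; inverseʳ)
open GroupProperties Aut-group public
  using ( ⁻¹-involutive; ⁻¹-anti-homo-∙; inverseˡ-unique
        ; //-rightDividesˡ; //-rightDividesʳ; \\-leftDividesˡ; \\-leftDividesʳ )

·-congˡ : ∀ p {q q′} → q ≈A q′ → (p · q) ≈A (p · q′)
·-congˡ p = ·-cong (≈A-refl {p})

·-congʳ : ∀ q {p p′} → p ≈A p′ → (p · q) ≈A (p′ · q)
·-congʳ q e = ·-cong e (≈A-refl {q})

TrivialBelow : ℕ → Aut → Set
TrivialBelow n p = AgreeBelow n p idA

pow : Aut → ℕ → Aut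
pow p zero = idA
pow p (suc m) = p · pow p m

pow-+ : ∀ p m n → pow p (m +ℕ n) ≈A (pow p m · pow p n)
pow-+ p zero n = ≈A-sym (identityˡ (pow p n))
pow-+ p (suc m) n = ≈A-trans (·-congˡ p (pow-+ p m n)) (≈A-sym (·-assoc p (pow p m) (pow p n)))

pow-2* : ∀ p m → pow p (2 *ℕ m) ≈A pow (p · p) m
pow-2* p zero = ≈A-refl
pow-2* p (suc m) = begin
  pow p (2 *ℕ suc m)         ≡⟨ cong (pow p) (*-suc 2 m) ⟩
  p · (p · pow p (2 *ℕ m))   ≈⟨ ·-assoc p p (pow p (2 *ℕ m)) ⟨
  (p · p) · pow p (2 *ℕ m)   ≈⟨ ·-congˡ (p · p) (pow-2* p m) ⟩
  (p · p) · pow (p · p) m    ∎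
  where open SetoidReasoning Aut-setoid

module _ {t : Aut} (root-fixed : t [] ≡ false) where

  pow-root : ∀ m → pow t m [] ≡ false
  pow-root zero = refl
  pow-root (suc m) rewrite root-fixed = pow-root m

  pow-sect : ∀ m b → sect (pow t m) b ≈A pow (sect t b) m
  pow-sect zero b = ≈A-refl
  pow-sect (suc m) b w = trans
    (cong (λ c → sect t b w xor sect (pow t m) c (act (sect t b) w))
      (trans (cong (b xor_) root-fixed) (xor-identityʳ b)))
    (·-congˡ (sect t b) (pow-sect m b) w)

pow-2^*-trivialBelow : ∀ k p c → TrivialBelow k (pow p (2 ^ k *ℕ c))
pow-2^*-trivialBelow zero p c v ()
pow-2^*-trivialBelow (suc k) p c v l =
  trans (cong (λ m → pow p m v) (*-assoc 2 (2 ^ k) c))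
        (trans (pow-2* p (2 ^ k *ℕ c) v) (square v l))
  where
  square : TrivialBelow (suc k) (pow (p · p) (2 ^ k *ℕ c))
  square [] _ = pow-root (xor-same (p [])) (2 ^ k *ℕ c)
  square (b ∷ w) (s≤s l) = trans (pow-sect (xor-same (p [])) (2 ^ k *ℕ c) b w)
                                 (pow-2^*-trivialBelow k (sect (p · p) b) c w l)

-- conjugation in the opposite convention to conj: cj c x = c x c⁻¹ = conj x (inv c)
cj : Aut → Aut → Aut
cj c x = (c · x) · inv c

cj-· : ∀ c x y → cj c (x · y) ≈A (cj c x · cj c y)
cj-· c x y = begin
  (c · (x · y)) · inv c                          ≈⟨ ·-congʳ (inv c) (·-assoc c x y) ⟨
  ((c · x) · y) · inv c                          ≈⟨ ·-congʳ (inv c) (·-congʳ y (//-rightDividesˡ c (c · x))) ⟨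
  ((((c · x) · inv c) · c) · y) · inv c          ≈⟨ ·-congʳ (inv c) (·-assoc ((c · x) · inv c) c y) ⟩
  (((c · x) · inv c) · (c · y)) · inv c          ≈⟨ ·-assoc ((c · x) · inv c) (c · y) (inv c) ⟩
  ((c · x) · inv c) · ((c · y) · inv c)          ∎
  where open SetoidReasoning Aut-setoid

cj-inv : ∀ c x → cj c (inv x) ≈A inv (cj c x)
cj-inv c x = ≈A-sym (begin
  inv ((c · x) · inv c)          ≈⟨ ⁻¹-anti-homo-∙ (c · x) (inv c) ⟩
  inv (inv c) · inv (c · x)      ≈⟨ ·-cong (⁻¹-involutive c) (⁻¹-anti-homo-∙ c x) ⟩
  c · (inv x · inv c)            ≈⟨ ·-assoc c (inv x) (inv c) ⟨
  (c · inv x) · inv c            ∎)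
  where open SetoidReasoning Aut-setoid

cj-trivialBelow : ∀ {n} c {t} → TrivialBelow n t → TrivialBelow n (cj c t)
cj-trivialBelow c triv = agree-trans (agree-· (agree-· (agree-refl {p = c}) triv) (agree-refl {p = inv c}))
  (≈⇒agree (≈A-trans (·-congʳ (inv c) (identityʳ c)) (inverseʳ c)))

cj-rotate : ∀ c w → (c · w) ≈A cj c (w · c)
cj-rotate c w = ≈A-sym (≈A-trans (·-assoc c (w · c) (inv c)) (·-congˡ c (//-rightDividesʳ c w)))

·-trivialBelow : ∀ {n} p {q} → TrivialBelow n q → AgreeBelow n (p · q) p
·-trivialBelow p triv = agree-trans (agree-· (agree-refl {p = p}) triv) (≈⇒agree (identityʳ p))

evalLetter : Aut × Bool → Aut
evalLetter (p , e) = if e then inv p else p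

evalWord-++ : ∀ xs ys → evalWord (xs ++ ys) ≈A (evalWord xs · evalWord ys)
evalWord-++ [] ys = ≈A-sym (identityˡ (evalWord ys))
evalWord-++ (x ∷ xs) ys = ≈A-trans (·-congˡ (evalLetter x) (evalWord-++ xs ys))
  (≈A-sym (·-assoc (evalLetter x) (evalWord xs) (evalWord ys)))

invertWith : ∀ {X : Set} → (X → X) → List X → List X
invertWith f [] = []
invertWith f (x ∷ xs) = invertWith f xs ++ f x ∷ []

all-invertWith : ∀ {X : Set} {P : X → Set} {f : X → X} → (∀ {x} → P x → P (f x)) →
  ∀ {xs} → All P xs → All P (invertWith f xs)
all-invertWith Pf [] = []
all-invertWith Pf (px ∷ pxs) = All.++⁺ (all-invertWith Pf pxs) (Pf px ∷ [])

evalWord-invertWith : ∀ {X : Set} (g : X → Aut × Bool) (f : X → X) →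
  (∀ x → evalLetter (g (f x)) ≈A inv (evalLetter (g x))) →
  ∀ xs → evalWord (map g (invertWith f xs)) ≈A inv (evalWord (map g xs))
evalWord-invertWith g f inv-letter [] _ = refl
evalWord-invertWith g f inv-letter (x ∷ xs) = begin
  evalWord (map g (invertWith f xs ++ f x ∷ []))
    ≡⟨ cong evalWord (map-++ g (invertWith f xs) (f x ∷ [])) ⟩
  evalWord (map g (invertWith f xs) ++ g (f x) ∷ [])
    ≈⟨ evalWord-++ (map g (invertWith f xs)) (g (f x) ∷ []) ⟩
  evalWord (map g (invertWith f xs)) · (evalLetter (g (f x)) · idA)
    ≈⟨ ·-cong (evalWord-invertWith g f inv-letter xs) (≈A-trans (identityʳ _) (inv-letter x)) ⟩
  inv (evalWord (map g xs)) · inv (evalLetter (g x))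
    ≈⟨ ⁻¹-anti-homo-∙ (evalLetter (g x)) (evalWord (map g xs)) ⟨
  inv (evalLetter (g x) · evalWord (map g xs)) ∎
  where open SetoidReasoning Aut-setoid

conj-·-inv : ∀ g h c → conj g (h · inv c) ≈A cj c (conj g h)
conj-·-inv g h c = begin
  (inv (h · inv c) · g) · (h · inv c)     ≈⟨ ·-congʳ (h · inv c) (·-congʳ g inv-h·c⁻¹) ⟩
  ((c · inv h) · g) · (h · inv c)         ≈⟨ ·-assoc ((c · inv h) · g) h (inv c) ⟨
  (((c · inv h) · g) · h) · inv c         ≈⟨ ·-congʳ (inv c) (·-congʳ h (·-assoc c (inv h) g)) ⟩
  ((c · (inv h · g)) · h) · inv c         ≈⟨ ·-congʳ (inv c) (·-assoc c (inv h · g) h) ⟩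
  (c · ((inv h · g) · h)) · inv c         ∎
  where
  open SetoidReasoning Aut-setoid
  inv-h·c⁻¹ : inv (h · inv c) ≈A (c · inv h)
  inv-h·c⁻¹ = ≈A-trans (⁻¹-anti-homo-∙ h (inv c)) (·-congʳ (inv h) (⁻¹-involutive c))

inv-conj : ∀ g h → inv (conj g h) ≈A conj (inv g) h
inv-conj g h = begin
  inv ((inv h · g) · h)          ≈⟨ ⁻¹-anti-homo-∙ (inv h · g) h ⟩
  inv h · inv (inv h · g)        ≈⟨ ·-congˡ (inv h) (⁻¹-anti-homo-∙ (inv h) g) ⟩
  inv h · (inv g · inv (inv h))  ≈⟨ ·-congˡ (inv h) (·-congˡ (inv g) (⁻¹-involutive h)) ⟩
  inv h · (inv g · h)            ≈⟨ ·-assoc (inv h) (inv g) h ⟨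
  (inv h · inv g) · h            ∎
  where open SetoidReasoning Aut-setoid

sect-· : ∀ p q b → sect (p · q) b ≈A (sect p b · sect q (b xor p []))
sect-· p q b _ = refl

sectAt : Aut → Word → Aut
sectAt p v w = p (v ++ w)

sectAt-agree : ∀ {m n p q} v → length v ≡ m → AgreeBelow (m +ℕ n) p q → AgreeBelow n (sectAt p v) (sectAt q v)
sectAt-agree v refl a w l = a (v ++ w) (subst (_< length v +ℕ _) (sym (length-++ v)) (+-monoʳ-< (length v) l))

-- Congruences modulo 2ⁿ and 2-adic integers

infix 4 _≡_mod_
record _≡_mod_ (a b : ℤ) (m : ℕ) : Set where
  constructor mk≡mod
  field
    quotient : ℤ
    equation : a ≡ b + quotient * + m

module _ {m : ℕ} where

  ≡⇒≡-mod : ∀ {a b} → a ≡ b → a ≡ b mod m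
  ≡⇒≡-mod {a} refl = mk≡mod 0ℤ (sym (trans (cong (_+_ a) (ℤ.*-zeroˡ (+ m))) (ℤ.+-identityʳ a)))

  mod-refl : ∀ a → a ≡ a mod m
  mod-refl a = ≡⇒≡-mod refl

  mod-sym : ∀ {a b} → a ≡ b mod m → b ≡ a mod m
  mod-sym {a} {b} (mk≡mod c e) = mk≡mod (- c) (trans (shift b c (+ m)) (cong (λ x → x + - c * + m) (sym e)))
    where shift : ∀ b c m → b ≡ (b + c * m) + - c * m
          shift = solve-∀

  mod-trans : ∀ {a b d} → a ≡ b mod m → b ≡ d mod m → a ≡ d mod m
  mod-trans {d = d} (mk≡mod c refl) (mk≡mod c′ refl) = mk≡mod (c′ + c) (regroup d c′ c (+ m))
    where regroup : ∀ d c′ c m → (d + c′ * m) + c * m ≡ d + (c′ + c) * m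
          regroup = solve-∀

  mod-+ : ∀ {a b a′ b′} → a ≡ b mod m → a′ ≡ b′ mod m → a + a′ ≡ b + b′ mod m
  mod-+ {b = b} {b′ = b′} (mk≡mod c refl) (mk≡mod c′ refl) = mk≡mod (c + c′) (regroup b b′ c c′ (+ m))
    where regroup : ∀ b b′ c c′ m → (b + c * m) + (b′ + c′ * m) ≡ (b + b′) + (c + c′) * m
          regroup = solve-∀

  mod-setoid : Setoid _ _
  mod-setoid = record
    { Carrier = ℤ ; _≈_ = _≡_mod m
    ; isEquivalence = record { refl = ≡⇒≡-mod refl ; sym = mod-sym ; trans = λ {a} {b} {d} → mod-trans {a} {b} {d} } }

mod-double : ∀ {m a b} → a ≡ b mod m → + 2 * a ≡ + 2 * b mod 2 *ℕ m
mod-double {m} {b = b} (mk≡mod c refl) =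
  mk≡mod c (trans (distrib b c (+ m)) (cong (λ x → + 2 * b + c * x) (sym (ℤ.pos-* 2 m))))
  where distrib : ∀ b c m → + 2 * (b + c * m) ≡ + 2 * b + c * (+ 2 * m)
        distrib = solve-∀

mod-weaken : ∀ k {m a b} → a ≡ b mod k *ℕ m → a ≡ b mod m
mod-weaken k {m} {b = b} (mk≡mod c refl) = mk≡mod (c * + k)
  (trans (cong (λ x → b + c * x) (ℤ.pos-* k m)) (cong (_+_ b) (sym (ℤ.*-assoc c (+ k) (+ m)))))

mod-1 : ∀ a b → a ≡ b mod 1
mod-1 a b = mk≡mod (a - b) (sym (trans (cong (_+_ b) (ℤ.*-identityʳ (a - b))) (cancel a b)))
  where cancel : ∀ a b → b + (a - b) ≡ a
        cancel = solve-∀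

%-≡-multiple : ∀ {a b m} .{{_ : NonZero m}} k → + a ≡ + b + + k * + m → a % m ≡ b % m
%-≡-multiple {a} {b} {m} k e = trans
  (cong (_% m) (ℤ.+-injective (trans e (trans (cong (_+_ (+ b)) (sym (ℤ.pos-* k m))) (sym (ℤ.pos-+ b (k *ℕ m)))))))
  ([m+kn]%n≡m%n b k m)

mod⇒%-≡ : ∀ {a b m} .{{_ : NonZero m}} → + a ≡ + b mod m → a % m ≡ b % m
mod⇒%-≡ (mk≡mod (+ k) e) = %-≡-multiple k e
mod⇒%-≡ {m = m} (mk≡mod -[1+ k ] e) = sym (%-≡-multiple (suc k) (_≡_mod_.equation (mod-sym {m} (mk≡mod -[1+ k ] e))))

2^≢0 : ∀ n → NonZero (2 ^ n)
2^≢0 n = m^n≢0 2 n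

%-below-double : ∀ M .{{_ : NonZero M}} {t} → t < M +ℕ M → (t ≡ t % M) ⊎ (t ≡ t % M +ℕ M)
%-below-double M {t} t<2M with t <? M
... | yes t<M = inj₁ (sym (m<n⇒m%n≡m t<M))
... | no t≮M = inj₂ (begin
  t                    ≡⟨ m∸n+n≡m M≤t ⟨
  (t ∸ M) +ℕ M         ≡⟨ cong (_+ℕ M) (m<n⇒m%n≡m t∸M<M) ⟨
  (t ∸ M) % M +ℕ M     ≡⟨ cong (_+ℕ M) (m≤n⇒[n∸m]%m≡n%m M≤t) ⟩
  t % M +ℕ M           ∎)
  where
  open ≡-Reasoning
  M≤t : M ≤ t
  M≤t = ≮⇒≥ t≮M
  t∸M<M : t ∸ M < M
  t∸M<M = subst (t ∸ M <_) (m+n∸n≡m M M) (∸-monoˡ-< t<2M M≤t)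

%-2^-step : ∀ a n → let instance _ = 2^≢0 n ; _ = 2^≢0 (suc n) in
  (a % 2 ^ suc n ≡ a % 2 ^ n) ⊎ (a % 2 ^ suc n ≡ a % 2 ^ n +ℕ 2 ^ n)
%-2^-step a n = subst (λ b → (a % 2 ^ suc n ≡ b) ⊎ (a % 2 ^ suc n ≡ b +ℕ 2 ^ n)) halve
  (%-below-double (2 ^ n) (subst (a % 2 ^ suc n <_) (cong (2 ^ n +ℕ_) (+-identityʳ (2 ^ n))) (m%n<n a (2 ^ suc n))))
  where
  instance _ = 2^≢0 n ; _ = 2^≢0 (suc n)
  halve : a % 2 ^ suc n % 2 ^ n ≡ a % 2 ^ n
  halve = m∣n⇒o%n%m≡o%m (2 ^ n) (2 ^ suc n) a (divides 2 refl)

%-+-split : ∀ M .{{_ : NonZero M}} a b c → (a +ℕ b) % M ≡ c % M →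
  (a % M +ℕ b % M ≡ c % M) ⊎ (a % M +ℕ b % M ≡ c % M +ℕ M)
%-+-split M a b c e = Sum.map (λ p → trans p same) (λ p → trans p (cong (_+ℕ M) same))
  (%-below-double M (+-mono-< (m%n<n a M) (m%n<n b M)))
  where
  same : (a % M +ℕ b % M) % M ≡ c % M
  same = trans (sym (%-distribˡ-+ a b M)) e

%≡0⇒mod : ∀ {a m} .{{_ : NonZero m}} → a % m ≡ 0 → + a ≡ 0ℤ mod m
%≡0⇒mod {a} {m} a%m≡0 = mk≡mod (+ (a / m)) (begin
  + a                        ≡⟨ cong +_ (trans (m≡m%n+[m/n]*n a m) (cong (_+ℕ (a / m) *ℕ m) a%m≡0)) ⟩
  + ((a / m) *ℕ m)           ≡⟨ ℤ.pos-* (a / m) m ⟩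
  + (a / m) * + m            ≡⟨ ℤ.+-identityˡ _ ⟨
  0ℤ + + (a / m) * + m       ∎)
  where open ≡-Reasoning

+-multiple-mod : ∀ a m c → + (a +ℕ m *ℕ c) ≡ + a mod m
+-multiple-mod a m c = mk≡mod (+ c) (begin
  + (a +ℕ m *ℕ c)        ≡⟨ ℤ.pos-+ a (m *ℕ c) ⟩
  + a + + (m *ℕ c)       ≡⟨ cong (λ k → + a + + k) (*-comm m c) ⟩
  + a + + (c *ℕ m)       ≡⟨ cong (_+_ (+ a)) (ℤ.pos-* c m) ⟩
  + a + + c * + m        ∎)
  where open ≡-Reasoning

ℤ₂-from-coherent : (f : ℕ → ℕ) → (∀ n → + f (suc n) ≡ + f n mod 2 ^ n) → ℤ₂
ℤ₂-from-coherent f coherent = record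
  { res = λ n → _%_ (f n) (2 ^ n) {{2^≢0 n}}
  ; res< = λ n → m%n<n (f n) (2 ^ n) {{2^≢0 n}}
  ; compat = λ n → let instance _ = 2^≢0 n in
      Sum.map (λ e → trans e (mod⇒%-≡ (coherent n)))
              (λ e → trans e (cong (_+ℕ 2 ^ n) (mod⇒%-≡ (coherent n))))
              (%-2^-step (f (suc n)) n)
  }

res-+ : ∀ (z : ℤ₂) k d → ∃ λ c → res z (d +ℕ k) ≡ res z k +ℕ 2 ^ k *ℕ c
res-+ z k zero = 0 , sym (trans (cong (res z k +ℕ_) (*-zeroʳ (2 ^ k))) (+-identityʳ (res z k)))
res-+ z k (suc d) with res-+ z k d | compat z (d +ℕ k)
... | c , e | inj₁ same = c , trans same e
... | c , e | inj₂ carry = c +ℕ 2 ^ d , (begin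
  res z (suc (d +ℕ k))                            ≡⟨ carry ⟩
  res z (d +ℕ k) +ℕ 2 ^ (d +ℕ k)
    ≡⟨ cong₂ _+ℕ_ e (trans (^-distribˡ-+-* 2 d k) (*-comm (2 ^ d) (2 ^ k))) ⟩
  (res z k +ℕ 2 ^ k *ℕ c) +ℕ 2 ^ k *ℕ 2 ^ d       ≡⟨ +-assoc (res z k) _ _ ⟩
  res z k +ℕ (2 ^ k *ℕ c +ℕ 2 ^ k *ℕ 2 ^ d)       ≡⟨ cong (res z k +ℕ_) (*-distribˡ-+ (2 ^ k) c (2 ^ d)) ⟨
  res z k +ℕ 2 ^ k *ℕ (c +ℕ 2 ^ d)                ∎)
  where open ≡-Reasoning

res-≡+2^* : ∀ (z : ℤ₂) {k L} → k ≤ L → ∃ λ c → res z L ≡ res z k +ℕ 2 ^ k *ℕ c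
res-≡+2^* z {k} {L} k≤L =
  subst (λ m → ∃ λ c → res z m ≡ res z k +ℕ 2 ^ k *ℕ c) (m∸n+n≡m k≤L) (res-+ z k (L ∸ k))

sumLevel : ℕ → (Word → ℤ) → ℤ
sumLevel zero f = f []
sumLevel (suc m) f = sumLevel m (λ v → f (false ∷ v)) + sumLevel m (λ v → f (true ∷ v))

sumLevelℕ : ℕ → (Word → ℕ) → ℕ
sumLevelℕ zero f = f []
sumLevelℕ (suc m) f = sumLevelℕ m (λ v → f (false ∷ v)) +ℕ sumLevelℕ m (λ v → f (true ∷ v))

+-sumLevelℕ : ∀ m f → + sumLevelℕ m f ≡ sumLevel m (λ v → + f v)
+-sumLevelℕ zero f = refl
+-sumLevelℕ (suc m) f =
  trans (ℤ.pos-+ (sumLevelℕ m (λ v → f (false ∷ v))) _) (cong₂ _+_ (+-sumLevelℕ m _) (+-sumLevelℕ m _))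

sumLevelℕ-cong : ∀ m {f g} → (∀ v → length v ≡ m → f v ≡ g v) → sumLevelℕ m f ≡ sumLevelℕ m g
sumLevelℕ-cong zero e = e [] refl
sumLevelℕ-cong (suc m) e = cong₂ _+ℕ_ (sumLevelℕ-cong m (λ v l → e (false ∷ v) (cong suc l)))
                                     (sumLevelℕ-cong m (λ v l → e (true ∷ v) (cong suc l)))

sumLevel-mod : ∀ m {k f g} → (∀ v → f v ≡ g v mod k) → sumLevel m f ≡ sumLevel m g mod k
sumLevel-mod zero e = e []
sumLevel-mod (suc m) e = mod-+ (sumLevel-mod m (λ v → e (false ∷ v))) (sumLevel-mod m (λ v → e (true ∷ v)))

-- Words in the generators

≡ᵇ-refl : ∀ m → (m ≡ᵇ m) ≡ true
≡ᵇ-refl m = Equivalence.to T-≡ (≡⇒≡ᵇ m m refl)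

≢⇒≡ᵇ-false : ∀ {m n} → m ≢ n → (m ≡ᵇ n) ≡ false
≢⇒≡ᵇ-false {m} {n} m≢n = ¬-not (λ e → m≢n (≡ᵇ⇒≡ m n (Equivalence.from T-≡ e)))

≡ᵇ-false⇒≢ : ∀ {m n} → (m ≡ᵇ n) ≡ false → m ≢ n
≡ᵇ-false⇒≢ {m} e refl with trans (sym e) (≡ᵇ-refl m)
... | ()

<⇒<ᵇ-true : ∀ {m n} → m < n → (m <ᵇ n) ≡ true
<⇒<ᵇ-true m<n = Equivalence.to T-≡ (<⇒<ᵇ m<n)

≥⇒<ᵇ-false : ∀ {m n} → n ≤ m → (m <ᵇ n) ≡ false
≥⇒<ᵇ-false {m} {n} n≤m = ¬-not (λ e → <⇒≱ (<ᵇ⇒< m n (Equivalence.from T-≡ e)) n≤m)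

n<ᵇn : ∀ n → (n <ᵇ n) ≡ false
n<ᵇn zero = refl
n<ᵇn (suc n) = n<ᵇn n

bit : Bool → ℕ
bit false = 0
bit true = 1

module Generators (r s : ℕ) where

  a : ℕ → Aut
  a = gen r s

  GenWord : Set
  GenWord = List (ℕ × Bool)

  letter : ℕ × Bool → Aut
  letter (j , e) = evalLetter (a j , e)

  ⟦_⟧ : GenWord → Aut
  ⟦ u ⟧ = evalWord (map (λ { (j , e) → (gen r s j , e) }) u)

  ⟦⟧-++ : ∀ u v → ⟦ u ++ v ⟧ ≈A (⟦ u ⟧ · ⟦ v ⟧)
  ⟦⟧-++ u v w = trans (cong (λ xs → evalWord xs w) (map-++ _ u v)) (evalWord-++ (map _ u) (map _ v) w)

  Valid : GenWord → Set
  Valid = All (λ { (j , e) → InRange r j })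

  ⟦replicate⟧ : ∀ m ℓ → ⟦ replicate m ℓ ⟧ ≈A pow (letter ℓ) m
  ⟦replicate⟧ zero ℓ = ≈A-refl
  ⟦replicate⟧ (suc m) ℓ = ·-congˡ (letter ℓ) (⟦replicate⟧ m ℓ)

  flipLetter : ℕ × Bool → ℕ × Bool
  flipLetter (j , e) = (j , not e)

  invW : GenWord → GenWord
  invW = invertWith flipLetter

  letter-flip : ∀ ℓ → letter (flipLetter ℓ) ≈A inv (letter ℓ)
  letter-flip (j , false) = ≈A-refl
  letter-flip (j , true) = ≈A-sym (⁻¹-involutive (a j))

  ⟦invW⟧ : ∀ u → ⟦ invW u ⟧ ≈A inv ⟦ u ⟧
  ⟦invW⟧ = evalWord-invertWith _ flipLetter letter-flip

  InG-⟦⟧ : ∀ {u} → Valid u → InG r s ⟦ u ⟧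
  InG-⟦⟧ {u} vu n = u , vu , agree-refl

  InG-idA : InG r s idA
  InG-idA = InG-⟦⟧ []

  InG-·letter⁻¹ : ∀ {h k} e → InRange r k → InG r s h → InG r s (h · inv (letter (k , e)))
  InG-·letter⁻¹ {h} {k} e rk h∈G n with h∈G n
  ... | ws , vws , ws≈h = ws ++ (k , not e) ∷ [] , All.++⁺ vws (rk ∷ []) , λ v l → trans
    (⟦⟧-++ ws ((k , not e) ∷ []) v)
    (agree-· ws≈h (≈⇒agree (≈A-trans (identityʳ (letter (k , not e))) (letter-flip (k , e)))) v l)

  valid-invW : ∀ {u} → Valid u → Valid (invW u)
  valid-invW = all-invertWith (λ rj → rj)

  prev : ℕ → ℕ
  prev j = if j ≡ᵇ 1 then r else j ∸ 1

  rooted : ℕ → Bool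
  rooted k = (k ≡ᵇ 1) ∨ (k ≡ᵇ s)

  -- a_k is (a_{k-1}, id)τ or (id, a_{k-1})τ (a₀ = a_r); side k is the first letter carrying a_{k-1}
  side : ℕ → Bool
  side k = if k ≡ᵇ 1 then false else ((k <ᵇ s) ∨ (k ≡ᵇ s))

  sect-a : ∀ k b → sect (a k) b ≈A (if side k xor b then idA else a (prev k))
  sect-a k b w with k ≡ᵇ 1
  ... | true with b
  ...   | true = refl
  ...   | false = refl
  sect-a k b w | false with (k <ᵇ s) ∨ (k ≡ᵇ s)
  ... | true with b
  ...   | true = refl
  ...   | false = refl
  sect-a k b w | false | false with b
  ... | true = refl
  ... | false = refl

  letter-root : ∀ ℓ → letter ℓ [] ≡ rooted (proj₁ ℓ)
  letter-root (k , false) = refl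
  letter-root (k , true) = refl

  rootParity : GenWord → Bool
  rootParity [] = false
  rootParity ((k , e) ∷ u) = rooted k xor rootParity u

  ⟦⟧-root : ∀ u → ⟦ u ⟧ [] ≡ rootParity u
  ⟦⟧-root [] = refl
  ⟦⟧-root (ℓ ∷ u) = cong₂ _xor_ (letter-root ℓ) (⟦⟧-root u)

  sectSide : ℕ × Bool → Bool
  sectSide (k , false) = side k
  sectSide (k , true) = side k xor rooted k

  sectLetter : ℕ × Bool → Bool → GenWord
  sectLetter (k , e) b = if sectSide (k , e) xor b then [] else (prev k , e) ∷ []

  sectWord : GenWord → Bool → GenWord
  sectWord [] b = []
  sectWord ((k , e) ∷ u) b = sectLetter (k , e) b ++ sectWord u (b xor rooted k)

  sectWordAt : GenWord → Word → GenWord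
  sectWordAt u [] = u
  sectWordAt u (b ∷ v) = sectWordAt (sectWord u b) v

  sect-letter : ∀ ℓ b → sect (letter ℓ) b ≈A ⟦ sectLetter ℓ b ⟧
  sect-letter (k , false) b with side k xor b | sect-a k b
  ... | true | e = e
  ... | false | e = ≈A-trans e (≈A-sym (identityʳ (a (prev k))))
  sect-letter (k , true) b rewrite sym (xor-rotate (side k) b (rooted k))
    with side k xor (b xor rooted k) | sect-a k (b xor rooted k)
  ... | true | e = inv-cong e
  ... | false | e = ≈A-trans (inv-cong e) (≈A-sym (identityʳ (inv (a (prev k)))))

  sect-⟦⟧ : ∀ u b → sect ⟦ u ⟧ b ≈A ⟦ sectWord u b ⟧
  sect-⟦⟧ [] b = ≈A-refl
  sect-⟦⟧ ((k , e) ∷ u) b = begin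
    sect (letter (k , e) · ⟦ u ⟧) b
      ≈⟨ sect-· (letter (k , e)) ⟦ u ⟧ b ⟩
    sect (letter (k , e)) b · sect ⟦ u ⟧ (b xor letter (k , e) [])
      ≡⟨ cong (λ c → sect (letter (k , e)) b · sect ⟦ u ⟧ (b xor c)) (letter-root (k , e)) ⟩
    sect (letter (k , e)) b · sect ⟦ u ⟧ (b xor rooted k)
      ≈⟨ ·-cong (sect-letter (k , e) b) (sect-⟦⟧ u (b xor rooted k)) ⟩
    ⟦ sectLetter (k , e) b ⟧ · ⟦ sectWord u (b xor rooted k) ⟧
      ≈⟨ ⟦⟧-++ (sectLetter (k , e) b) _ ⟨
    ⟦ sectWord ((k , e) ∷ u) b ⟧ ∎
    where open SetoidReasoning Aut-setoid

  sectAt-⟦⟧ : ∀ u v → sectAt ⟦ u ⟧ v ≈A ⟦ sectWordAt u v ⟧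
  sectAt-⟦⟧ u [] = ≈A-refl
  sectAt-⟦⟧ u (b ∷ v) w = trans (sect-⟦⟧ u b (v ++ w)) (sectAt-⟦⟧ (sectWord u b) v w)

  rootParity-++ : ∀ u v → rootParity (u ++ v) ≡ rootParity u xor rootParity v
  rootParity-++ [] v = refl
  rootParity-++ ((k , e) ∷ u) v =
    trans (cong (rooted k xor_) (rootParity-++ u v)) (sym (xor-assoc (rooted k) (rootParity u) (rootParity v)))

  sectWord-++ : ∀ u v b → sectWord (u ++ v) b ≡ sectWord u b ++ sectWord v (b xor rootParity u)
  sectWord-++ [] v b = cong (sectWord v) (sym (xor-identityʳ b))
  sectWord-++ ((k , e) ∷ u) v b = begin
    sectLetter (k , e) b ++ sectWord (u ++ v) (b xor rooted k)
      ≡⟨ cong (sectLetter (k , e) b ++_) (sectWord-++ u v (b xor rooted k)) ⟩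
    sectLetter (k , e) b ++ (sectWord u (b xor rooted k) ++ sectWord v ((b xor rooted k) xor rootParity u))
      ≡⟨ ++-assoc (sectLetter (k , e) b) _ _ ⟨
    (sectLetter (k , e) b ++ sectWord u (b xor rooted k)) ++ sectWord v ((b xor rooted k) xor rootParity u)
      ≡⟨ cong (λ c → (sectLetter (k , e) b ++ sectWord u (b xor rooted k)) ++ sectWord v c)
              (xor-assoc b (rooted k) (rootParity u)) ⟩
    (sectLetter (k , e) b ++ sectWord u (b xor rooted k)) ++ sectWord v (b xor (rooted k xor rootParity u)) ∎
    where open ≡-Reasoning

  run : ℕ → ℕ → GenWord
  run k zero = []
  run k (suc m) = (k , false) ∷ run (suc k) m

  run-++ : ∀ k m n → run k (m +ℕ n) ≡ run k m ++ run (k +ℕ m) n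
  run-++ k zero n = cong (λ k′ → run k′ n) (sym (+-identityʳ k))
  run-++ k (suc m) n = cong ((k , false) ∷_)
    (trans (run-++ (suc k) m n) (cong (λ k′ → run (suc k) m ++ run k′ n) (sym (+-suc k m))))

  valid-run : ∀ m k → 1 ≤ k → k +ℕ m ≤ suc r → Valid (run k m)
  valid-run zero k _ _ = []
  valid-run (suc m) k 1≤k k+m≤ =
    (1≤k , ≤-trans (m≤m+n k m) (≤-pred (subst (_≤ suc r) (+-suc k m) k+m≤)))
    ∷ valid-run m (suc k) (s≤s z≤n) (subst (_≤ suc r) (+-suc k m) k+m≤)

  Passive : Bool → ℕ → Set
  Passive c j = side j ≡ c × rooted j ≡ false

  module _ (c : Bool) where

    run-rootParity : ∀ m k → (∀ {j} → k ≤ j → j < k +ℕ m → Passive c j) → rootParity (run k m) ≡ false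
    run-rootParity zero k passive = refl
    run-rootParity (suc m) k passive rewrite proj₂ (passive ≤-refl (m<m+n k (s≤s z≤n))) =
      run-rootParity m (suc k) (λ {j} k<j j< → passive (<⇒≤ k<j) (subst (j <_) (sym (+-suc k m)) j<))

    run-sectWord : ∀ m k → (∀ {j} → suc k ≤ j → j < suc k +ℕ m → Passive c j) →
      ∀ b → sectWord (run (suc k) m) b ≡ (if c xor b then [] else run k m)
    run-sectWord zero k passive b = sym (if-eta (c xor b))
    run-sectWord (suc m) k passive b = begin
      sectLetter (suc k , false) b ++ sectWord (run (suc (suc k)) m) (b xor rooted (suc k))
        ≡⟨ cong₂ _++_ first-letter rest ⟩
      (if c xor b then [] else (k , false) ∷ []) ++ (if c xor b then [] else run (suc k) m)
        ≡⟨ merge (c xor b) ⟩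
      (if c xor b then [] else (k , false) ∷ run (suc k) m) ∎
      where
      open ≡-Reasoning
      passive-k : Passive c (suc k)
      passive-k = passive ≤-refl (m<m+n (suc k) (s≤s z≤n))
      first-letter : sectLetter (suc k , false) b ≡ (if c xor b then [] else (k , false) ∷ [])
      first-letter = cong₂ (λ x y → if x xor b then [] else (y , false) ∷ [])
        (proj₁ passive-k) (cong (λ t → if t then r else k) (∨-conicalˡ _ _ (proj₂ passive-k)))
      rest : sectWord (run (suc (suc k)) m) (b xor rooted (suc k)) ≡ (if c xor b then [] else run (suc k) m)
      rest = trans (cong (λ t → sectWord (run (suc (suc k)) m) (b xor t)) (proj₂ passive-k))
        (trans (cong (sectWord (run (suc (suc k)) m)) (xor-identityʳ b))
          (run-sectWord m (suc k) (λ {j} k<j j< → passive (<⇒≤ k<j) (subst (j <_) (sym (+-suc (suc k) m)) j<)) b))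
      merge : ∀ x → (if x then [] else (k , false) ∷ []) ++ (if x then [] else run (suc k) m)
                  ≡ (if x then [] else (k , false) ∷ run (suc k) m)
      merge true = refl
      merge false = refl

  δ : ℕ → ℕ → ℤ
  δ k j = if k ≡ᵇ j then 1ℤ else 0ℤ

  letterWeight : ℕ → ℕ → ℕ × Bool → ℤ
  letterWeight p q (k , false) = δ k p - δ k q
  letterWeight p q (k , true) = - (δ k p - δ k q)

  weight : ℕ → ℕ → GenWord → ℤ
  weight p q [] = 0ℤ
  weight p q (ℓ ∷ u) = letterWeight p q ℓ + weight p q u

  letterWeight-other : ∀ {p q k} e → k ≢ p → k ≢ q → letterWeight p q (k , e) ≡ 0ℤ
  letterWeight-other false k≢p k≢q rewrite ≢⇒≡ᵇ-false k≢p | ≢⇒≡ᵇ-false k≢q = refl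
  letterWeight-other true k≢p k≢q rewrite ≢⇒≡ᵇ-false k≢p | ≢⇒≡ᵇ-false k≢q = refl

  weight-++ : ∀ p q u v → weight p q (u ++ v) ≡ weight p q u + weight p q v
  weight-++ p q [] v = sym (ℤ.+-identityˡ (weight p q v))
  weight-++ p q (ℓ ∷ u) v =
    trans (cong (_+_ (letterWeight p q ℓ)) (weight-++ p q u v)) (sym (ℤ.+-assoc (letterWeight p q ℓ) _ _))

  weight-invW : ∀ p q u → weight p q (invW u) ≡ - weight p q u
  weight-invW p q [] = refl
  weight-invW p q ((k , e) ∷ u) = begin
    weight p q (invW u ++ (k , not e) ∷ [])                 ≡⟨ weight-++ p q (invW u) _ ⟩
    weight p q (invW u) + (letterWeight p q (k , not e) + 0ℤ)
      ≡⟨ cong₂ (λ w l → w + (l + 0ℤ)) (weight-invW p q u) (flip-weight e) ⟩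
    - weight p q u + (- letterWeight p q (k , e) + 0ℤ)       ≡⟨ negate (weight p q u) (letterWeight p q (k , e)) ⟩
    - (letterWeight p q (k , e) + weight p q u)               ∎
    where
    open ≡-Reasoning
    flip-weight : ∀ e → letterWeight p q (k , not e) ≡ - letterWeight p q (k , e)
    flip-weight false = refl
    flip-weight true = sym (ℤ.neg-involutive _)
    negate : ∀ w l → - w + (- l + 0ℤ) ≡ - (l + w)
    negate = solve-∀

  prev^ : ℕ → ℕ → ℕ
  prev^ zero j = j
  prev^ (suc m) j = prev^ m (prev j)

  prev^-+ : ∀ m n j → prev^ (m +ℕ n) j ≡ prev^ n (prev^ m j)
  prev^-+ zero n j = refl
  prev^-+ (suc m) n j = prev^-+ m n (prev j)

  prev^-< : ∀ {m j} → m < j → prev^ m j ≡ j ∸ m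
  prev^-< {zero} _ = refl
  prev^-< {suc m} {suc (suc j)} (s≤s m<j) = prev^-< m<j

  prev^-self : ∀ j → prev^ (suc j) (suc j) ≡ r
  prev^-self zero = refl
  prev^-self (suc j) = prev^-self j

  prev^-wrap : ∀ j {t} → t < r → prev^ (suc j +ℕ t) (suc j) ≡ r ∸ t
  prev^-wrap j {t} t<r = trans (prev^-+ (suc j) t (suc j)) (trans (cong (prev^ t) (prev^-self j)) (prev^-< t<r))

  prev^-cycle : ∀ {j} → InRange r j → prev^ r j ≡ j
  prev^-cycle {suc j} (_ , j<r) = begin
    prev^ r (suc j)                       ≡⟨ cong (λ m → prev^ m (suc j)) (m+[n∸m]≡n j<r) ⟨
    prev^ (suc j +ℕ (r ∸ suc j)) (suc j)  ≡⟨ prev^-wrap j (∸-monoʳ-< (s≤s z≤n) j<r) ⟩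
    r ∸ (r ∸ suc j)                       ≡⟨ m∸[m∸n]≡n j<r ⟩
    suc j                                 ∎
    where open ≡-Reasoning

  -- the binary expansion of the (s, 1)-weight: its parity is the root label, and the remaining half is
  -- the sum of the (s, 1)-weights of the sections at the vertices 0v with |v| = r − 1 (see coord-⟦⟧)
  coord : ℕ → Aut → ℕ
  coord zero p = 0
  coord (suc n) p = bit (p []) +ℕ 2 *ℕ sumLevelℕ (r ∸ 1) (λ v → coord n (sectAt p (false ∷ v)))

  module Cyclic (1≤r : 1 ≤ r) where

    suc-r∸1 : suc (r ∸ 1) ≡ r
    suc-r∸1 = m+[n∸m]≡n 1≤r

    prev^-prev-cycle : ∀ {j} → InRange r j → prev^ (r ∸ 1) (prev j) ≡ j
    prev^-prev-cycle rj = trans (cong (λ m → prev^ m _) suc-r∸1) (prev^-cycle rj)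

    coord-agree : ∀ n {p q} → AgreeBelow (r *ℕ n) p q → coord n p ≡ coord n q
    coord-agree zero a = refl
    coord-agree (suc n) a rewrite *-suc r n = cong₂ _+ℕ_
      (cong bit (a [] (≤-trans 1≤r (m≤m+n r (r *ℕ n)))))
      (cong (2 *ℕ_) (sumLevelℕ-cong (r ∸ 1) λ v l →
        coord-agree n (sectAt-agree (false ∷ v) (trans (cong suc l) suc-r∸1) a)))

    coord-cong : ∀ n {p q} → p ≈A q → coord n p ≡ coord n q
    coord-cong n e = coord-agree n (≈⇒agree e)


    prev-inRange : ∀ {k} → InRange r k → InRange r (prev k)
    prev-inRange {suc zero} _ = 1≤r , ≤-refl
    prev-inRange {suc (suc k)} (_ , k≤r) = s≤s z≤n , ≤-trans (n≤1+n (suc k)) k≤r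

    prev-injective : ∀ {k j} → InRange r k → InRange r j → prev k ≡ prev j → k ≡ j
    prev-injective {suc zero} {suc zero} _ _ e = refl
    prev-injective {suc zero} {suc (suc j)} _ (_ , j≤r) e = ⊥-elim (n≮n (suc j) (subst (suc (suc j) ≤_) e j≤r))
    prev-injective {suc (suc k)} {suc zero} (_ , k≤r) _ e = ⊥-elim (n≮n (suc k) (subst (suc (suc k) ≤_) (sym e) k≤r))
    prev-injective {suc (suc k)} {suc (suc j)} _ _ e = cong suc e

    prev-≡ᵇ : ∀ {k j} → InRange r k → InRange r j → (prev k ≡ᵇ prev j) ≡ (k ≡ᵇ j)
    prev-≡ᵇ {k} {j} rk rj with k ≟ j
    ... | yes refl = trans (≡ᵇ-refl (prev k)) (sym (≡ᵇ-refl k))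
    ... | no k≢j = trans (≢⇒≡ᵇ-false (k≢j ∘ prev-injective rk rj)) (sym (≢⇒≡ᵇ-false k≢j))

    letterWeight-prev : ∀ {p q k} e → InRange r p → InRange r q → InRange r k →
      letterWeight (prev p) (prev q) (prev k , e) ≡ letterWeight p q (k , e)
    letterWeight-prev false rp rq rk rewrite prev-≡ᵇ rk rp | prev-≡ᵇ rk rq = refl
    letterWeight-prev true rp rq rk rewrite prev-≡ᵇ rk rp | prev-≡ᵇ rk rq = refl

    valid-sectLetter : ∀ {k} e b → InRange r k → Valid (sectLetter (k , e) b)
    valid-sectLetter {k} e b rk with sectSide (k , e) xor b
    ... | true = []
    ... | false = prev-inRange rk ∷ []

    valid-sectWord : ∀ u b → Valid u → Valid (sectWord u b)
    valid-sectWord [] b [] = []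
    valid-sectWord ((k , e) ∷ u) b (rk ∷ vu) =
      All.++⁺ (valid-sectLetter e b rk) (valid-sectWord u (b xor rooted k) vu)

    valid-sectWordAt : ∀ u v → Valid u → Valid (sectWordAt u v)
    valid-sectWordAt u [] vu = vu
    valid-sectWordAt u (b ∷ v) vu = valid-sectWordAt (sectWord u b) v (valid-sectWord u b vu)

    weight-sectLetter : ∀ {p q k} e b → InRange r p → InRange r q → InRange r k →
      weight (prev p) (prev q) (sectLetter (k , e) b)
        ≡ (if sectSide (k , e) xor b then 0ℤ else letterWeight p q (k , e))
    weight-sectLetter {k = k} e b rp rq rk with sectSide (k , e) xor b
    ... | true = refl
    ... | false = trans (ℤ.+-identityʳ _) (letterWeight-prev e rp rq rk)

    -- exactly one of the two sections of a letter carries it, with its index shifted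
    weight-sectLetter-split : ∀ {p q k} e → InRange r p → InRange r q → InRange r k →
      weight (prev p) (prev q) (sectLetter (k , e) false) + weight (prev p) (prev q) (sectLetter (k , e) true)
        ≡ letterWeight p q (k , e)
    weight-sectLetter-split {p} {q} {k} e rp rq rk
      rewrite weight-sectLetter e false rp rq rk | weight-sectLetter e true rp rq rk
      with sectSide (k , e)
    ... | false = ℤ.+-identityʳ _
    ... | true = ℤ.+-identityˡ _

    weight-sectWord-split : ∀ {p q} u → InRange r p → InRange r q → Valid u →
      weight (prev p) (prev q) (sectWord u false) + weight (prev p) (prev q) (sectWord u true) ≡ weight p q u
    weight-sectWord-split [] rp rq [] = refl
    weight-sectWord-split {p} {q} ((k , e) ∷ u) rp rq (rk ∷ vu) = begin
      W (sectLetter (k , e) false ++ S (false xor rooted k)) + W (sectLetter (k , e) true ++ S (true xor rooted k))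
        ≡⟨ cong₂ _+_ (weight-++ (prev p) (prev q) (sectLetter (k , e) false) _)
                     (weight-++ (prev p) (prev q) (sectLetter (k , e) true) _) ⟩
      (L false + W (S (false xor rooted k))) + (L true + W (S (true xor rooted k)))
        ≡⟨ interchange (L false) (W (S (false xor rooted k))) (L true) (W (S (true xor rooted k))) ⟩
      (L false + L true) + (W (S (false xor rooted k)) + W (S (true xor rooted k)))
        ≡⟨ cong₂ _+_ (weight-sectLetter-split e rp rq rk) (sections-swap (rooted k)) ⟩
      letterWeight p q (k , e) + weight p q u ∎
      where
      open ≡-Reasoning
      W : GenWord → ℤ
      W = weight (prev p) (prev q)
      S : Bool → GenWord
      S = sectWord u
      L : Bool → ℤ
      L b = W (sectLetter (k , e) b)
      sections-swap : ∀ c → W (S (false xor c)) + W (S (true xor c)) ≡ weight p q u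
      sections-swap false = weight-sectWord-split u rp rq vu
      sections-swap true = trans (ℤ.+-comm (W (S true)) (W (S false))) (weight-sectWord-split u rp rq vu)

    weight-sectWordAt-sum : ∀ m {p q} u → InRange r p → InRange r q → Valid u →
      sumLevel m (λ v → weight (prev^ m p) (prev^ m q) (sectWordAt u v)) ≡ weight p q u
    weight-sectWordAt-sum zero u rp rq vu = refl
    weight-sectWordAt-sum (suc m) u rp rq vu = trans
      (cong₂ _+_
        (weight-sectWordAt-sum m (sectWord u false) (prev-inRange rp) (prev-inRange rq) (valid-sectWord u false vu))
        (weight-sectWordAt-sum m (sectWord u true) (prev-inRange rp) (prev-inRange rq) (valid-sectWord u true vu)))
      (weight-sectWord-split u rp rq vu)

  module Coordinates (1<s : 1 < s) (s≤r : s ≤ r) where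

    1≤r : 1 ≤ r
    1≤r = ≤-trans (<⇒≤ 1<s) s≤r

    open Cyclic 1≤r

    s-inRange : InRange r s
    s-inRange = <⇒≤ 1<s , s≤r

    1-inRange : InRange r 1
    1-inRange = ≤-refl , 1≤r

    s≢1 : s ≢ 1
    s≢1 refl = n≮n 1 1<s

    sectWeight : Bool → GenWord → ℤ
    sectWeight b u = weight (prev s) (prev 1) (sectWord u b)

    letterSectWeight : ℕ × Bool → Bool → ℤ
    letterSectWeight ℓ b = weight (prev s) (prev 1) (sectLetter ℓ b)

    -- only a_1 and a_s are rooted, and they carry a_r resp. a_{s-1} at opposite sides
    letter-halving : ∀ k e → InRange r k →
      letterWeight s 1 (k , e) ≡ + bit (rooted k) + + 2 * letterSectWeight (k , e) false
    letter-halving k e rk rewrite weight-sectLetter e false s-inRange 1-inRange rk with k ≟ 1 | k ≟ s | e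
    ... | yes refl | _ | false rewrite ≢⇒≡ᵇ-false (s≢1 ∘ sym) = refl
    ... | yes refl | _ | true rewrite ≢⇒≡ᵇ-false (s≢1 ∘ sym) = refl
    ... | no _ | yes refl | false rewrite ≢⇒≡ᵇ-false s≢1 | ≡ᵇ-refl s | n<ᵇn s = refl
    ... | no _ | yes refl | true rewrite ≢⇒≡ᵇ-false s≢1 | ≡ᵇ-refl s | n<ᵇn s = refl
    ... | no k≢1 | no k≢s | e' rewrite letterWeight-other e' k≢s k≢1 | if-eta (sectSide (k , e') xor false) {0ℤ}
                                     | ≢⇒≡ᵇ-false k≢1 | ≢⇒≡ᵇ-false k≢s = refl

    sectWeight-true : ∀ u → Valid u → weight s 1 u ≡ + bit (rootParity u) + + 2 * sectWeight false u →
      sectWeight true u ≡ sectWeight false u + + bit (rootParity u)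
    sectWeight-true u vu halving = begin
      sectWeight true u                          ≡⟨ add-sub W₀ (sectWeight true u) ⟩
      (W₀ + sectWeight true u) - W₀              ≡⟨ cong (_- W₀) (weight-sectWord-split u s-inRange 1-inRange vu) ⟩
      weight s 1 u - W₀                          ≡⟨ cong (_- W₀) halving ⟩
      (+ bit (rootParity u) + + 2 * W₀) - W₀     ≡⟨ halve (+ bit (rootParity u)) W₀ ⟩
      W₀ + + bit (rootParity u)                  ∎
      where
      open ≡-Reasoning
      W₀ : ℤ
      W₀ = sectWeight false u
      add-sub : ∀ x y → y ≡ (x + y) - x
      add-sub = solve-∀
      halve : ∀ b x → (b + + 2 * x) - x ≡ x + b
      halve = solve-∀

    word-halving : ∀ u → Valid u → weight s 1 u ≡ + bit (rootParity u) + + 2 * sectWeight false u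
    word-halving [] [] = refl
    word-halving ((k , e) ∷ u) (rk ∷ vu) = begin
      letterWeight s 1 (k , e) + weight s 1 u
        ≡⟨ cong₂ _+_ (letter-halving k e rk) (word-halving u vu) ⟩
      (+ bit (rooted k) + + 2 * letterSectWeight (k , e) false) + (+ bit (rootParity u) + + 2 * sectWeight false u)
        ≡⟨ carry (rooted k) (rootParity u) (letterSectWeight (k , e) false) (λ b → sectWeight b u)
                 (sectWeight-true u vu (word-halving u vu)) ⟩
      + bit (rooted k xor rootParity u) + + 2 * (letterSectWeight (k , e) false + sectWeight (rooted k) u)
        ≡⟨ cong (λ z → + bit (rooted k xor rootParity u) + + 2 * z)
                (sym (weight-++ (prev s) (prev 1) (sectLetter (k , e) false) _)) ⟩
      + bit (rootParity ((k , e) ∷ u)) + + 2 * sectWeight false ((k , e) ∷ u) ∎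
      where
      open ≡-Reasoning
      carry : ∀ c c′ x (w : Bool → ℤ) → w true ≡ w false + + bit c′ →
        (+ bit c + + 2 * x) + (+ bit c′ + + 2 * w false) ≡ + bit (c xor c′) + + 2 * (x + w c)
      carry false c′ x w _ = even (+ bit c′) x (w false)
        where even : ∀ b x y → (+ 0 + + 2 * x) + (b + + 2 * y) ≡ b + + 2 * (x + y)
              even = solve-∀
      carry true false x w e rewrite e = odd x (w false)
        where odd : ∀ x y → (+ 1 + + 2 * x) + (+ 0 + + 2 * y) ≡ + 1 + + 2 * (x + (y + + 0))
              odd = solve-∀
      carry true true x w e rewrite e = overflow x (w false)
        where overflow : ∀ x y → (+ 1 + + 2 * x) + (+ 1 + + 2 * y) ≡ + 0 + + 2 * (x + (y + + 1))
              overflow = solve-∀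

    coord-suc-⟦⟧ : ∀ n u → + coord (suc n) ⟦ u ⟧
      ≡ + bit (rootParity u) + + 2 * sumLevel (r ∸ 1) (λ v → + coord n ⟦ sectWordAt (sectWord u false) v ⟧)
    coord-suc-⟦⟧ n u = begin
      + (bit (⟦ u ⟧ []) +ℕ 2 *ℕ S)      ≡⟨ ℤ.pos-+ (bit (⟦ u ⟧ [])) (2 *ℕ S) ⟩
      + bit (⟦ u ⟧ []) + + (2 *ℕ S)      ≡⟨ cong₂ (λ b x → + bit b + x) (⟦⟧-root u) (ℤ.pos-* 2 S) ⟩
      + bit (rootParity u) + + 2 * + S   ≡⟨ cong (λ x → + bit (rootParity u) + + 2 * + x) S≡ ⟩
      + bit (rootParity u) + + 2 * + S′  ≡⟨ cong (λ x → + bit (rootParity u) + + 2 * x) (+-sumLevelℕ (r ∸ 1) _) ⟩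
      _                                  ∎
      where
      open ≡-Reasoning
      S S′ : ℕ
      S = sumLevelℕ (r ∸ 1) (λ v → coord n (sectAt ⟦ u ⟧ (false ∷ v)))
      S′ = sumLevelℕ (r ∸ 1) (λ v → coord n ⟦ sectWordAt u (false ∷ v) ⟧)
      S≡ : S ≡ S′
      S≡ = sumLevelℕ-cong (r ∸ 1) (λ v _ → coord-cong n (sectAt-⟦⟧ u (false ∷ v)))

    coord-⟦⟧ : ∀ n u → Valid u → + coord n ⟦ u ⟧ ≡ weight s 1 u mod 2 ^ n
    coord-⟦⟧ zero u vu = mod-1 _ _
    coord-⟦⟧ (suc n) u vu = begin
      + coord (suc n) ⟦ u ⟧
        ≡⟨ coord-suc-⟦⟧ n u ⟩
      + bit (rootParity u) + + 2 * sumLevel (r ∸ 1) (λ v → + coord n ⟦ sectWordAt u₀ v ⟧)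
        ≈⟨ mod-+ (mod-refl (+ bit (rootParity u))) (mod-double (sumLevel-mod (r ∸ 1) λ v →
             coord-⟦⟧ n (sectWordAt u₀ v) (valid-sectWordAt u₀ v (valid-sectWord u false vu)))) ⟩
      + bit (rootParity u) + + 2 * sumLevel (r ∸ 1) (λ v → weight s 1 (sectWordAt u₀ v))
        ≡⟨ cong (λ x → + bit (rootParity u) + + 2 * x) sections-sum ⟩
      + bit (rootParity u) + + 2 * sectWeight false u
        ≡⟨ word-halving u vu ⟨
      weight s 1 u ∎
      where
      open SetoidReasoning (mod-setoid {2 ^ suc n})
      u₀ : GenWord
      u₀ = sectWord u false
      sections-sum : sumLevel (r ∸ 1) (λ v → weight s 1 (sectWordAt u₀ v)) ≡ sectWeight false u
      sections-sum = subst₂ (λ p q → sumLevel (r ∸ 1) (λ v → weight p q (sectWordAt u₀ v)) ≡ sectWeight false u)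
        (prev^-prev-cycle s-inRange) (prev^-prev-cycle 1-inRange)
        (weight-sectWordAt-sum (r ∸ 1) u₀ (prev-inRange s-inRange) (prev-inRange 1-inRange) (valid-sectWord u false vu))

    s∸2 r∸s : ℕ
    s∸2 = s ∸ 2
    r∸s = r ∸ s

    2+s∸2≡s : 2 +ℕ s∸2 ≡ s
    2+s∸2≡s = m+[n∸m]≡n 1<s

    r≡ : r ≡ suc (s∸2 +ℕ suc r∸s)
    r≡ = begin
      r                    ≡⟨ m+[n∸m]≡n s≤r ⟨
      s +ℕ r∸s               ≡⟨ cong (_+ℕ r∸s) 2+s∸2≡s ⟨
      suc (suc (s∸2 +ℕ r∸s))  ≡⟨ cong suc (+-suc s∸2 r∸s) ⟨
      suc (s∸2 +ℕ suc r∸s)    ∎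
      where open ≡-Reasoning

    low-passive : ∀ {j} → 2 ≤ j → j < s → Passive true j
    low-passive {j} 2≤j j<s rewrite ≢⇒≡ᵇ-false {j} {1} (λ j≡1 → n≮n 1 (subst (1 <_) j≡1 2≤j))
      | <⇒<ᵇ-true j<s | ≢⇒≡ᵇ-false {j} {s} (λ j≡s → n≮n j (subst (j <_) (sym j≡s) j<s)) = refl , refl

    high-passive : ∀ {j} → suc s ≤ j → Passive false j
    high-passive {j} s<j rewrite ≢⇒≡ᵇ-false {j} {1} (λ j≡1 → n≮n 1 (<-≤-trans 1<s (<⇒≤ (subst (s <_) j≡1 s<j))))
      | ≥⇒<ᵇ-false (<⇒≤ s<j) | ≢⇒≡ᵇ-false {j} {s} (λ j≡s → n≮n j (subst (_< j) (sym j≡s) s<j)) = refl , refl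

    Q : GenWord
    Q = run 1 r

    low high : GenWord
    low = run 2 s∸2
    high = run (suc s) r∸s

    Q-split : Q ≡ (1 , false) ∷ (low ++ (s , false) ∷ high)
    Q-split = begin
      run 1 r
        ≡⟨ cong (run 1) r≡ ⟩
      (1 , false) ∷ run 2 (s∸2 +ℕ suc r∸s)
        ≡⟨ cong ((1 , false) ∷_) (run-++ 2 s∸2 (suc r∸s)) ⟩
      (1 , false) ∷ (low ++ run (2 +ℕ s∸2) (suc r∸s))
        ≡⟨ cong (λ k → (1 , false) ∷ (low ++ run k (suc r∸s))) 2+s∸2≡s ⟩
      (1 , false) ∷ (low ++ (s , false) ∷ high)                ∎
      where open ≡-Reasoning

    low-rootParity : rootParity low ≡ false
    low-rootParity = run-rootParity true s∸2 2 (λ {j} 2≤j j< → low-passive 2≤j (subst (j <_) 2+s∸2≡s j<))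

    low-sectWord : ∀ b → sectWord low b ≡ (if true xor b then [] else run 1 s∸2)
    low-sectWord = run-sectWord true s∸2 1 (λ {j} 2≤j j< → low-passive 2≤j (subst (j <_) 2+s∸2≡s j<))

    high-rootParity : rootParity high ≡ false
    high-rootParity = run-rootParity false r∸s (suc s) (λ s<j _ → high-passive s<j)

    high-sectWord : ∀ b → sectWord high b ≡ (if false xor b then [] else run s r∸s)
    high-sectWord = run-sectWord false r∸s s (λ s<j _ → high-passive s<j)

    rooted-s : rooted s ≡ true
    rooted-s rewrite ≢⇒≡ᵇ-false s≢1 | ≡ᵇ-refl s = refl

    side-s : side s ≡ true
    side-s rewrite ≢⇒≡ᵇ-false s≢1 | n<ᵇn s | ≡ᵇ-refl s = refl

    prev-s : prev s ≡ s ∸ 1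
    prev-s rewrite ≢⇒≡ᵇ-false s≢1 = refl

    Q-rootParity : rootParity Q ≡ false
    Q-rootParity rewrite Q-split | rootParity-++ low ((s , false) ∷ high) | low-rootParity | rooted-s | high-rootParity = refl

    Q-sectWord-true : sectWord Q true ≡ []
    Q-sectWord-true rewrite Q-split | sectWord-++ low ((s , false) ∷ high) false | low-sectWord false | low-rootParity
      | side-s | rooted-s | high-sectWord true = refl

    R : GenWord
    R = run 1 (r ∸ 1)

    Q-sectWord-false : sectWord Q false ≡ (r , false) ∷ R
    Q-sectWord-false rewrite Q-split | sectWord-++ low ((s , false) ∷ high) true | low-sectWord true | low-rootParity
      | side-s | rooted-s | high-sectWord false | prev-s = cong ((r , false) ∷_) (sym R-split)
      where
      R-split : R ≡ run 1 s∸2 ++ (s ∸ 1 , false) ∷ run s r∸s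
      R-split = begin
        run 1 (r ∸ 1)                                    ≡⟨ cong (λ m → run 1 (m ∸ 1)) r≡ ⟩
        run 1 (s∸2 +ℕ suc r∸s)                              ≡⟨ run-++ 1 s∸2 (suc r∸s) ⟩
        run 1 s∸2 ++ (suc s∸2 , false) ∷ run (2 +ℕ s∸2) r∸s
          ≡⟨ cong (λ k → run 1 s∸2 ++ (k ∸ 1 , false) ∷ run k r∸s) 2+s∸2≡s ⟩
        run 1 s∸2 ++ (s ∸ 1 , false) ∷ run s r∸s            ∎
        where open ≡-Reasoning

    Q-rotate : Q ≡ R ++ (r , false) ∷ []
    Q-rotate = begin
      run 1 r                              ≡⟨ cong (run 1) (trans (sym suc-r∸1) (+-comm 1 (r ∸ 1))) ⟩
      run 1 ((r ∸ 1) +ℕ 1)                 ≡⟨ run-++ 1 (r ∸ 1) 1 ⟩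
      R ++ (suc (r ∸ 1) , false) ∷ []      ≡⟨ cong (λ k → R ++ (k , false) ∷ []) suc-r∸1 ⟩
      R ++ (r , false) ∷ []                ∎
      where open ≡-Reasoning

    -- the first-level section of a₁a₂⋯a_r is its conjugate a_r a₁⋯a_{r-1}
    Q-rotated-conj : ⟦ (r , false) ∷ R ⟧ ≈A cj (a r) ⟦ Q ⟧
    Q-rotated-conj = ≈A-trans (cj-rotate (a r) ⟦ R ⟧) (·-congʳ (inv (a r)) (·-congˡ (a r) (≈A-sym (begin
      ⟦ Q ⟧                          ≡⟨ cong ⟦_⟧ Q-rotate ⟩
      ⟦ R ++ (r , false) ∷ [] ⟧      ≈⟨ ⟦⟧-++ R ((r , false) ∷ []) ⟩
      ⟦ R ⟧ · (a r · idA)            ≈⟨ ·-congˡ ⟦ R ⟧ (identityʳ (a r)) ⟩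
      ⟦ R ⟧ · a r                    ∎))))
      where open SetoidReasoning Aut-setoid

    Q-trivialBelow : ∀ n → TrivialBelow n ⟦ Q ⟧
    Q-trivialBelow zero v ()
    Q-trivialBelow (suc n) [] _ = trans (⟦⟧-root Q) Q-rootParity
    Q-trivialBelow (suc n) (true ∷ w) (s≤s l) = trans (sect-⟦⟧ Q true w) (cong (λ u → ⟦ u ⟧ w) Q-sectWord-true)
    Q-trivialBelow (suc n) (false ∷ w) (s≤s l) = trans (sect-⟦⟧ Q false w)
      (trans (cong (λ u → ⟦ u ⟧ w) Q-sectWord-false)
        (trans (Q-rotated-conj w) (cj-trivialBelow (a r) (Q-trivialBelow n) w l)))

    Q-trivial : ⟦ Q ⟧ ≈A idA
    Q-trivial v = Q-trivialBelow (suc (length v)) v ≤-refl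

    -- The quotient G/N_i

    module Quotient (i : ℕ) (1≤i : 1 ≤ i) (i≤r : i ≤ r) where

      i-inRange : InRange r i
      i-inRange = 1≤i , i≤r

      -- at depth d the (i, i′)-weight becomes the (s, 1)-weight
      d : ℕ
      d = (i +ℕ r ∸ s) % suc (r ∸ 1)

      i′ : ℕ
      i′ = shiftIdx r s i

      i′-inRange : InRange r i′
      i′-inRange = s≤s z≤n , subst (d <_) suc-r∸1 (m%n<n (i +ℕ r ∸ s) (suc (r ∸ 1)))

      d-cases : (s ≤ i × d ≡ i ∸ s) ⊎ (i < s × d ≡ i +ℕ r∸s)
      d-cases with s ≤? i
      ... | yes s≤i = inj₁ (s≤i , (begin
        ((i +ℕ r) ∸ s) % suc (r ∸ 1)              ≡⟨ cong (_% suc (r ∸ 1)) (+-∸-comm r s≤i) ⟩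
        ((i ∸ s) +ℕ r) % suc (r ∸ 1)              ≡⟨ cong (λ m → ((i ∸ s) +ℕ m) % suc (r ∸ 1)) suc-r∸1 ⟨
        ((i ∸ s) +ℕ suc (r ∸ 1)) % suc (r ∸ 1)    ≡⟨ [m+n]%n≡m%n (i ∸ s) (suc (r ∸ 1)) ⟩
        (i ∸ s) % suc (r ∸ 1)                     ≡⟨ m<n⇒m%n≡m (subst (i ∸ s <_) (sym suc-r∸1) (<-≤-trans i∸s<i i≤r)) ⟩
        i ∸ s                                     ∎))
        where
        open ≡-Reasoning
        i∸s<i : i ∸ s < i
        i∸s<i = ∸-monoʳ-< (<-trans (s≤s z≤n) 1<s) s≤i
      ... | no s≰i = inj₂ (≰⇒> s≰i , trans (cong (_% suc (r ∸ 1)) (+-∸-assoc i s≤r)) (m<n⇒m%n≡m i+r∸s<r))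
        where
        i+r∸s<r : i +ℕ r∸s < suc (r ∸ 1)
        i+r∸s<r = subst (i +ℕ r∸s <_) (trans (m+[n∸m]≡n s≤r) (sym suc-r∸1)) (+-monoˡ-< r∸s (≰⇒> s≰i))

      prev^-d-i : prev^ d i ≡ s
      prev^-d-i with d-cases
      ... | inj₁ (s≤i , d≡) rewrite d≡ = trans (prev^-< (∸-monoʳ-< (<-trans (s≤s z≤n) 1<s) s≤i)) (m∸[m∸n]≡n s≤i)
      ... | inj₂ (i<s , d≡) rewrite d≡ = wrap i 1≤i
        where
        wrap : ∀ k → 1 ≤ k → prev^ (k +ℕ r∸s) k ≡ s
        wrap (suc k) _ = trans (prev^-wrap k (∸-monoʳ-< (<-trans (s≤s z≤n) 1<s) s≤r)) (m∸[m∸n]≡n s≤r)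

      prev^-d-i′ : prev^ d i′ ≡ 1
      prev^-d-i′ = trans (prev^-< {d} ≤-refl) (m+n∸n≡m 1 d)

      i≢i′ : i ≢ i′
      i≢i′ i≡i′ with d-cases
      ... | inj₁ (s≤i , d≡) = s≢1 (+-cancelˡ-≡ (i ∸ s) s 1 (begin
        (i ∸ s) +ℕ s    ≡⟨ m∸n+n≡m s≤i ⟩
        i               ≡⟨ trans i≡i′ (cong suc d≡) ⟩
        suc (i ∸ s)     ≡⟨ +-comm 1 (i ∸ s) ⟩
        (i ∸ s) +ℕ 1    ∎))
        where open ≡-Reasoning
      ... | inj₂ (i<s , d≡) = n≮n i (subst (i <_) (sym (trans i≡i′ (cong suc d≡))) (s≤s (m≤m+n i r∸s)))

      Φ : ℕ → Aut → ℕ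
      Φ n p = sumLevelℕ d (λ v → coord n (sectAt p v))

      level : ℕ → ℕ
      level n = d +ℕ r *ℕ n

      Φ-agree : ∀ n {p q} → AgreeBelow (level n) p q → Φ n p ≡ Φ n q
      Φ-agree n a = sumLevelℕ-cong d (λ v l → coord-agree n (sectAt-agree v l a))

      Φ-⟦⟧ : ∀ n u → Valid u → + Φ n ⟦ u ⟧ ≡ weight i i′ u mod 2 ^ n
      Φ-⟦⟧ n u vu = begin
        + Φ n ⟦ u ⟧                                     ≡⟨ +-sumLevelℕ d _ ⟩
        sumLevel d (λ v → + coord n (sectAt ⟦ u ⟧ v))   ≈⟨ sumLevel-mod d section-coord ⟩
        sumLevel d (λ v → weight s 1 (sectWordAt u v))  ≡⟨ sections-sum ⟩
        weight i i′ u                                   ∎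
        where
        open SetoidReasoning (mod-setoid {2 ^ n})
        section-coord : ∀ v → + coord n (sectAt ⟦ u ⟧ v) ≡ weight s 1 (sectWordAt u v) mod 2 ^ n
        section-coord v = mod-trans (≡⇒≡-mod (cong +_ (coord-cong n (sectAt-⟦⟧ u v))))
                                    (coord-⟦⟧ n (sectWordAt u v) (valid-sectWordAt u v vu))
        sections-sum : sumLevel d (λ v → weight s 1 (sectWordAt u v)) ≡ weight i i′ u
        sections-sum = subst₂ (λ p q → sumLevel d (λ v → weight p q (sectWordAt u v)) ≡ weight i i′ u)
          prev^-d-i prev^-d-i′ (weight-sectWordAt-sum d u i-inRange i′-inRange vu)

      Φ-approx : ∀ n {γ} u → Valid u → AgreeBelow (level n) ⟦ u ⟧ γ → + Φ n γ ≡ weight i i′ u mod 2 ^ n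
      Φ-approx n u vu a = subst (λ m → + m ≡ weight i i′ u mod 2 ^ n) (Φ-agree n a) (Φ-⟦⟧ n u vu)

      NWord : Set
      NWord = List (Aut × ℕ × Bool)

      nLetter : Aut × ℕ × Bool → Aut × Bool
      nLetter (h , j , e) = (conj (a j) h , e)

      ⟦_⟧ₙ : NWord → Aut
      ⟦ ns ⟧ₙ = evalWord (map nLetter ns)

      GoodLetter : Aut × ℕ × Bool → Set
      GoodLetter (h , j , e) = InG r s h × Allowed r s i j

      Good : NWord → Set
      Good = All GoodLetter

      -- the normal closure in G of the allowed generators, before taking the topological closure
      InK : Aut → Set
      InK p = ∃ λ ns → Good ns × p ≈A ⟦ ns ⟧ₙ

      ⟦⟧ₙ-++ : ∀ ns ms → ⟦ ns ++ ms ⟧ₙ ≈A (⟦ ns ⟧ₙ · ⟦ ms ⟧ₙ)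
      ⟦⟧ₙ-++ ns ms w = trans (cong (λ xs → evalWord xs w) (map-++ nLetter ns ms))
                             (evalWord-++ (map nLetter ns) (map nLetter ms) w)

      K-resp : ∀ {p q} → p ≈A q → InK p → InK q
      K-resp p≈q (ns , good , p≈ns) = ns , good , ≈A-trans (≈A-sym p≈q) p≈ns

      K-idA : InK idA
      K-idA = [] , [] , ≈A-refl

      K-· : ∀ {p q} → InK p → InK q → InK (p · q)
      K-· (ns , gns , p≈) (ms , gms , q≈) =
        ns ++ ms , All.++⁺ gns gms , ≈A-trans (·-cong p≈ q≈) (≈A-sym (⟦⟧ₙ-++ ns ms))

      K-inv : ∀ {p} → InK p → InK (inv p)
      K-inv (ns , gns , p≈) = invertWith flipN ns , all-invertWith (λ g → g) gns ,
        ≈A-trans (inv-cong p≈) (≈A-sym (evalWord-invertWith nLetter flipN flip-inv ns))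
        where
        flipN : Aut × ℕ × Bool → Aut × ℕ × Bool
        flipN (h , j , e) = (h , j , not e)
        flip-inv : ∀ n → evalLetter (nLetter (flipN n)) ≈A inv (evalLetter (nLetter n))
        flip-inv (h , j , false) = ≈A-refl
        flip-inv (h , j , true) = ≈A-sym (⁻¹-involutive (conj (a j) h))

      K-cj : ∀ {c p} → (∀ {h} → InG r s h → InG r s (h · inv c)) → InK p → InK (cj c p)
      K-cj {c} shift (ns , gns , p≈) = map conjN ns , All.gmap⁺ (λ {n} → shift-good {n}) gns ,
        ≈A-trans (·-congʳ (inv c) (·-congˡ c p≈)) (≈A-sym (⟦conjN⟧ ns))
        where
        conjN : Aut × ℕ × Bool → Aut × ℕ × Bool
        conjN (h , j , e) = (h · inv c , j , e)
        shift-good : ∀ {n} → GoodLetter n → GoodLetter (conjN n)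
        shift-good (h∈G , allowed) = shift h∈G , allowed
        conjN-letter : ∀ n → evalLetter (nLetter (conjN n)) ≈A cj c (evalLetter (nLetter n))
        conjN-letter (h , j , false) = conj-·-inv (a j) h c
        conjN-letter (h , j , true) = ≈A-trans (inv-cong (conj-·-inv (a j) h c)) (≈A-sym (cj-inv c (conj (a j) h)))
        ⟦conjN⟧ : ∀ ns → ⟦ map conjN ns ⟧ₙ ≈A cj c ⟦ ns ⟧ₙ
        ⟦conjN⟧ [] = ≈A-sym (≈A-trans (·-congʳ (inv c) (identityʳ c)) (inverseʳ c))
        ⟦conjN⟧ (n ∷ ns) = ≈A-trans (·-cong (conjN-letter n) (⟦conjN⟧ ns))
                                    (≈A-sym (cj-· c (evalLetter (nLetter n)) ⟦ ns ⟧ₙ))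

      K-letter : ∀ {k} e → InRange r k → k ≢ i → k ≢ i′ → InK (letter (k , e))
      K-letter {k} e rk k≢i k≢i′ = (idA , k , e) ∷ [] , (InG-idA , rk , k≢i , k≢i′) ∷ [] ,
        ≈A-sym (≈A-trans (identityʳ _) (conj-idA e))
        where
        conj-idA : ∀ e → evalLetter (conj (a k) idA , e) ≈A letter (k , e)
        conj-idA false = ≈A-trans (identityʳ (inv idA · a k)) (identityˡ (a k))
        conj-idA true = inv-cong (≈A-trans (identityʳ (inv idA · a k)) (identityˡ (a k)))

      infix 4 _∼_
      record _∼_ (p q : Aut) : Set where
        constructor mk∼
        field
          factor : Aut
          factor∈K : InK factor
          equation : p ≈A (factor · q)

      ∼-reflexive : ∀ {p q} → p ≈A q → p ∼ q
      ∼-reflexive {q = q} p≈q = mk∼ idA K-idA (≈A-trans p≈q (≈A-sym (identityˡ q)))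

      ∼-trans : ∀ {p q t} → p ∼ q → q ∼ t → p ∼ t
      ∼-trans {t = t} (mk∼ n n∈K p≈) (mk∼ m m∈K q≈) =
        mk∼ (n · m) (K-· n∈K m∈K) (≈A-trans p≈ (≈A-trans (·-congˡ n q≈) (≈A-sym (·-assoc n m t))))

      ∼-preorder : Preorder _ _ _
      ∼-preorder = record
        { isPreorder = record
          { isEquivalence = ≈A-isEquivalence ; reflexive = ∼-reflexive ; trans = λ {p} {q} {t} → ∼-trans {p} {q} {t} } }

      K-∼ : ∀ {n} → InK n → ∀ q → (n · q) ∼ q
      K-∼ {n} n∈K q = mk∼ n n∈K ≈A-refl

      ∼-letter· : ∀ {k} e → InRange r k → ∀ {p q} → p ∼ q → (letter (k , e) · p) ∼ (letter (k , e) · q)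
      ∼-letter· {k} e rk {p} {q} (mk∼ n n∈K p≈) = mk∼ (cj c n) (K-cj {c} (InG-·letter⁻¹ e rk) n∈K) (begin
        c · p                     ≈⟨ ·-congˡ c p≈ ⟩
        c · (n · q)               ≈⟨ ·-assoc c n q ⟨
        (c · n) · q               ≈⟨ ·-congʳ q (//-rightDividesˡ c (c · n)) ⟨
        (cj c n · c) · q          ≈⟨ ·-assoc (cj c n) c q ⟩
        cj c n · (c · q)          ∎)
        where
        c = letter (k , e)
        open SetoidReasoning Aut-setoid

      isXY : ℕ → Bool
      isXY k = (k ≡ᵇ i) ∨ (k ≡ᵇ i′)

      keepXY : GenWord → GenWord
      keepXY [] = []
      keepXY ((k , e) ∷ u) = if isXY k then (k , e) ∷ keepXY u else keepXY u

      ⟦⟧-∼-keepXY : ∀ u → Valid u → ⟦ u ⟧ ∼ ⟦ keepXY u ⟧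
      ⟦⟧-∼-keepXY [] [] = ∼-reflexive ≈A-refl
      ⟦⟧-∼-keepXY ((k , e) ∷ u) (rk ∷ vu) with isXY k in xy
      ... | true = ∼-letter· e rk (⟦⟧-∼-keepXY u vu)
      ... | false = ∼-trans (∼-letter· e rk (⟦⟧-∼-keepXY u vu))
        (K-∼ (K-letter e rk (≡ᵇ-false⇒≢ (∨-conicalˡ (k ≡ᵇ i) _ xy)) (≡ᵇ-false⇒≢ (∨-conicalʳ _ (k ≡ᵇ i′) xy)))
             ⟦ keepXY u ⟧)

      isXY-other : ∀ {j} → j ≢ i → j ≢ i′ → isXY j ≡ false
      isXY-other j≢i j≢i′ rewrite ≢⇒≡ᵇ-false j≢i | ≢⇒≡ᵇ-false j≢i′ = refl

      module KeepRun {p q : ℕ} (p<q : p < q) (xy-p : isXY p ≡ true) (xy-q : isXY q ≡ true)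
                     (others : ∀ {j} → j ≢ p → j ≢ q → isXY j ≡ false) where

        keep-none : ∀ m a → q < a → keepXY (run a m) ≡ []
        keep-none zero a q<a = refl
        keep-none (suc m) a q<a rewrite others (λ a≡p → n≮n a (subst (_< a) (sym a≡p) (<-trans p<q q<a)))
                                              (λ a≡q → n≮n a (subst (_< a) (sym a≡q) q<a)) =
          keep-none m (suc a) (<-trans q<a (n<1+n a))

        keep-one : ∀ m a → p < a → a ≤ q → q < a +ℕ m → keepXY (run a m) ≡ (q , false) ∷ []
        keep-one zero a p<a a≤q q<a+0 = ⊥-elim (n≮n q (<-≤-trans q<a+0 (subst (_≤ q) (sym (+-identityʳ a)) a≤q)))
        keep-one (suc m) a p<a a≤q q< with a ≟ q
        ... | yes refl rewrite xy-q = cong ((a , false) ∷_) (keep-none m (suc a) (n<1+n a))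
        ... | no a≢q rewrite others (λ a≡p → n≮n a (subst (_< a) (sym a≡p) p<a)) a≢q =
          keep-one m (suc a) (<-trans p<a (n<1+n a)) (≤∧≢⇒< a≤q a≢q) (subst (q <_) (+-suc a m) q<)

        keep-two : ∀ m a → a ≤ p → q < a +ℕ m → keepXY (run a m) ≡ (p , false) ∷ (q , false) ∷ []
        keep-two zero a a≤p q<a+0 =
          ⊥-elim (n≮n q (<-≤-trans q<a+0 (subst (_≤ q) (sym (+-identityʳ a)) (≤-trans a≤p (<⇒≤ p<q)))))
        keep-two (suc m) a a≤p q< with a ≟ p
        ... | yes refl rewrite xy-p = cong ((a , false) ∷_) (keep-one m (suc a) (n<1+n a) p<q (subst (q <_) (+-suc a m) q<))
        ... | no a≢p
          rewrite others a≢p (λ a≡q → n≮n a (subst (a <_) (sym a≡q) (<-≤-trans (≤∧≢⇒< a≤p a≢p) (<⇒≤ p<q)))) =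
          keep-two m (suc a) (≤∧≢⇒< a≤p a≢p) (subst (q <_) (+-suc a m) q<)

      x y : Aut
      x = a i
      y = a i′

      isXY-i : isXY i ≡ true
      isXY-i rewrite ≡ᵇ-refl i = refl

      isXY-i′ : isXY i′ ≡ true
      isXY-i′ rewrite ≡ᵇ-refl i′ = ∨-zeroʳ _

      idA∼keepXY-Q : idA ∼ ⟦ keepXY Q ⟧
      idA∼keepXY-Q = ∼-trans (∼-reflexive (≈A-sym Q-trivial)) (⟦⟧-∼-keepXY Q (valid-run r 1 ≤-refl ≤-refl))

      ∼idA⇒K-inv : ∀ {z} → idA ∼ z → InK (inv z)
      ∼idA⇒K-inv {z} (mk∼ n n∈K id≈) = K-resp (inverseˡ-unique n z (≈A-sym id≈)) n∈K

      K-inv-inv : ∀ {p} → InK (inv p) → InK p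
      K-inv-inv {p} = K-resp (⁻¹-involutive p) ∘ K-inv

      -- modulo K, a₁a₂⋯a_r = 1 becomes xy = 1 or yx = 1, depending on whether i < i′
      yx∈K×[xy]⁻¹∈K : InK (y · x) × InK (inv (x · y))
      yx∈K×[xy]⁻¹∈K with <-cmp i i′
      ... | tri< i<i′ _ _ =
        K-resp yx≈ (K-cj {inv x} (InG-·letter⁻¹ true i-inRange) (K-inv-inv {x · y} [xy]⁻¹∈K)) , [xy]⁻¹∈K
        where
        [xy]⁻¹∈K : InK (inv (x · y))
        [xy]⁻¹∈K = K-resp (inv-cong (·-congˡ x (identityʳ y)))
          (∼idA⇒K-inv (subst (λ u → idA ∼ ⟦ u ⟧)
            (KeepRun.keep-two i<i′ isXY-i isXY-i′ isXY-other r 1 1≤i (s≤s (proj₂ i′-inRange)))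
            idA∼keepXY-Q))
        yx≈ : cj (inv x) (x · y) ≈A (y · x)
        yx≈ = ·-cong (\\-leftDividesʳ x y) (⁻¹-involutive x)
      ... | tri> _ _ i′<i = yx∈K , K-inv (K-resp xy≈ (K-cj {x} (InG-·letter⁻¹ false i-inRange) yx∈K))
        where
        yx∈K : InK (y · x)
        yx∈K = K-inv-inv (K-resp (inv-cong (·-congˡ y (identityʳ x)))
          (∼idA⇒K-inv (subst (λ u → idA ∼ ⟦ u ⟧)
            (KeepRun.keep-two i′<i isXY-i′ isXY-i (λ j≢i′ j≢i → isXY-other j≢i j≢i′)
                              r 1 (proj₁ i′-inRange) (s≤s i≤r))
            idA∼keepXY-Q)))
        xy≈ : cj x (y · x) ≈A (x · y)
        xy≈ = ≈A-trans (·-congʳ (inv x) (≈A-sym (·-assoc x y x))) (//-rightDividesʳ x (x · y))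
      ... | tri≈ _ i≡i′ _ = ⊥-elim (i≢i′ i≡i′)

      xpow : ℤ → GenWord
      xpow (+ n) = replicate n (i , false)
      xpow -[1+ n ] = replicate (suc n) (i , true)

      x·xpow : ∀ w → (x · ⟦ xpow w ⟧) ≈A ⟦ xpow (1ℤ + w) ⟧
      x·xpow (+ n) = ≈A-refl
      x·xpow -[1+ zero ] = ≈A-trans (·-congˡ x (identityʳ (inv x))) (inverseʳ x)
      x·xpow -[1+ suc n ] = \\-leftDividesˡ x ⟦ replicate (suc n) (i , true) ⟧

      x⁻¹·xpow : ∀ w → (inv x · ⟦ xpow w ⟧) ≈A ⟦ xpow (-1ℤ + w) ⟧
      x⁻¹·xpow (+ zero) = ≈A-refl
      x⁻¹·xpow (+ suc n) = \\-leftDividesʳ x ⟦ replicate n (i , false) ⟧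
      x⁻¹·xpow -[1+ n ] = ≈A-refl

      letter-step : ∀ k e → InRange r k → ∀ w →
        (letter (k , e) · ⟦ xpow w ⟧) ∼ ⟦ xpow (letterWeight i i′ (k , e) + w) ⟧
      letter-step k e rk w with k ≟ i | k ≟ i′ | e
      ... | yes refl | _ | false rewrite ≡ᵇ-refl i | ≢⇒≡ᵇ-false i≢i′ = ∼-reflexive (x·xpow w)
      ... | yes refl | _ | true rewrite ≡ᵇ-refl i | ≢⇒≡ᵇ-false i≢i′ = ∼-reflexive (x⁻¹·xpow w)
      ... | no k≢i | yes refl | false rewrite ≢⇒≡ᵇ-false k≢i | ≡ᵇ-refl i′ = begin
        y · X                       ≈⟨ ·-congˡ y (\\-leftDividesˡ x X) ⟨
        y · (x · (inv x · X))       ≈⟨ ·-assoc y x (inv x · X) ⟨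
        (y · x) · (inv x · X)       ∼⟨ K-∼ (proj₁ yx∈K×[xy]⁻¹∈K) (inv x · X) ⟩
        inv x · X                   ≈⟨ x⁻¹·xpow w ⟩
        ⟦ xpow (-1ℤ + w) ⟧          ∎
        where
        X = ⟦ xpow w ⟧
        open PreorderReasoning ∼-preorder
      ... | no k≢i | yes refl | true rewrite ≢⇒≡ᵇ-false k≢i | ≡ᵇ-refl i′ = begin
        inv y · X                      ≈⟨ ·-congˡ (inv y) (\\-leftDividesʳ x X) ⟨
        inv y · (inv x · (x · X))      ≈⟨ ·-assoc (inv y) (inv x) (x · X) ⟨
        (inv y · inv x) · (x · X)      ≈⟨ ·-congʳ (x · X) (⁻¹-anti-homo-∙ x y) ⟨
        inv (x · y) · (x · X)          ∼⟨ K-∼ (proj₂ yx∈K×[xy]⁻¹∈K) (x · X) ⟩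
        x · X                          ≈⟨ x·xpow w ⟩
        ⟦ xpow (1ℤ + w) ⟧              ∎
        where
        X = ⟦ xpow w ⟧
        open PreorderReasoning ∼-preorder
      ... | no k≢i | no k≢i′ | e′ rewrite letterWeight-other {i} {i′} e′ k≢i k≢i′ | ℤ.+-identityˡ w =
        K-∼ (K-letter e′ rk k≢i k≢i′) ⟦ xpow w ⟧

      word-∼-xpow : ∀ u → Valid u → ⟦ u ⟧ ∼ ⟦ xpow (weight i i′ u) ⟧
      word-∼-xpow [] [] = ∼-reflexive ≈A-refl
      word-∼-xpow ((k , e) ∷ u) (rk ∷ vu) =
        ∼-trans (∼-letter· e rk (word-∼-xpow u vu)) (letter-step k e rk (weight i i′ u))

      xpow-trivialBelow : ∀ n {w} → w ≡ 0ℤ mod 2 ^ n → TrivialBelow n ⟦ xpow w ⟧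
      xpow-trivialBelow n {w} (mk≡mod c e) =
        by-sign w (trans (cong ∣_∣ (trans e (ℤ.+-identityˡ (c * + (2 ^ n))))) (ℤ.abs-* c (+ (2 ^ n))))
        where
        power : ∀ p {m} → m ≡ ∣ c ∣ *ℕ 2 ^ n → TrivialBelow n (pow p m)
        power p m≡ = subst (λ m → TrivialBelow n (pow p m)) (sym (trans m≡ (*-comm ∣ c ∣ (2 ^ n))))
                           (pow-2^*-trivialBelow n p ∣ c ∣)
        by-sign : ∀ w → ∣ w ∣ ≡ ∣ c ∣ *ℕ 2 ^ n → TrivialBelow n ⟦ xpow w ⟧
        by-sign (+ m) m≡ = agree-trans (≈⇒agree (⟦replicate⟧ m (i , false))) (power x m≡)
        by-sign -[1+ m ] m≡ = agree-trans (≈⇒agree (⟦replicate⟧ (suc m) (i , true))) (power (inv x) m≡)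

      weight-xpow : ∀ m → weight i i′ (xpow (+ m)) ≡ + m
      weight-xpow zero = refl
      weight-xpow (suc m) rewrite weight-xpow m | ≡ᵇ-refl i | ≢⇒≡ᵇ-false i≢i′ = refl

      level-mono : ∀ n → level n ≤ level (suc n)
      level-mono n = +-monoʳ-≤ d (*-monoʳ-≤ r (n≤1+n n))

      n≤level : ∀ n → n ≤ level n
      n≤level n = ≤-trans (m≤n*m n r {{>-nonZero 1≤r}}) (m≤n+m (r *ℕ n) d)

      Φ-coherent : ∀ {γ} → InG r s γ → ∀ n → + Φ (suc n) γ ≡ + Φ n γ mod 2 ^ n
      Φ-coherent γ∈G n with γ∈G (level (suc n))
      ... | u , vu , u≈γ = mod-trans (mod-weaken 2 (Φ-approx (suc n) u vu u≈γ))
                                     (mod-sym (Φ-approx n u vu (agree-weaken (level-mono n) u≈γ)))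

      φ : GElt r s → ℤ₂
      φ (γ , γ∈G) = ℤ₂-from-coherent (λ n → Φ n γ) (Φ-coherent γ∈G)

      φ-respects-≈ : ∀ g h → proj₁ g ≈A proj₁ h → φ g ≈₂ φ h
      φ-respects-≈ g h g≈h n = cong (λ m → _%_ m (2 ^ n) {{2^≢0 n}}) (Φ-agree n (≈⇒agree g≈h))

      φ-continuous : ∀ n → ∃ λ m → ∀ g h → AgreeBelow m (proj₁ g) (proj₁ h) → res (φ g) n ≡ res (φ h) n
      φ-continuous n = level n , λ g h g≈h → cong (λ m → _%_ m (2 ^ n) {{2^≢0 n}}) (Φ-agree n g≈h)

      φ-homomorphism : ∀ g h k → proj₁ k ≈A (proj₁ g · proj₁ h) → IsSum (φ k) (φ g) (φ h)
      φ-homomorphism (γ , γ∈G) (η , η∈G) (κ , _) κ≈γη n with γ∈G (level n) | η∈G (level n)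
      ... | u , vu , u≈γ | u′ , vu′ , u′≈η =
        %-+-split (2 ^ n) (Φ n γ) (Φ n η) (Φ n κ) (sym (mod⇒%-≡ Φκ≡Φγ+Φη))
        where
        instance _ = 2^≢0 n
        open SetoidReasoning (mod-setoid {2 ^ n})
        Φκ≡Φγ+Φη : + Φ n κ ≡ + (Φ n γ +ℕ Φ n η) mod 2 ^ n
        Φκ≡Φγ+Φη = begin
          + Φ n κ                           ≈⟨ Φ-approx n (u ++ u′) (All.++⁺ vu vu′) uu′≈κ ⟩
          weight i i′ (u ++ u′)             ≡⟨ weight-++ i i′ u u′ ⟩
          weight i i′ u + weight i i′ u′    ≈⟨ mod-+ (mod-sym (Φ-approx n u vu u≈γ)) (mod-sym (Φ-approx n u′ vu′ u′≈η)) ⟩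
          + Φ n γ + + Φ n η                 ≡⟨ ℤ.pos-+ (Φ n γ) (Φ n η) ⟨
          + (Φ n γ +ℕ Φ n η)                ∎
          where
          uu′≈κ : AgreeBelow (level n) ⟦ u ++ u′ ⟧ κ
          uu′≈κ v l = trans (⟦⟧-++ u u′ v) (trans (agree-· u≈γ u′≈η v l) (sym (κ≈γη v)))

      module Preimage (z : ℤ₂) where

        γ : Aut
        γ v = pow x (res z (suc (length v))) v

        xpow-approx : ∀ L → AgreeBelow L ⟦ xpow (+ res z L) ⟧ γ
        xpow-approx L v l with res-≡+2^* z l
        ... | c , zL≡ = begin
          ⟦ xpow (+ res z L) ⟧ v                     ≡⟨ ⟦replicate⟧ (res z L) (i , false) v ⟩
          pow x (res z L) v                           ≡⟨ cong (λ m → pow x m v) zL≡ ⟩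
          pow x (res z k +ℕ 2 ^ k *ℕ c) v             ≡⟨ pow-+ x (res z k) (2 ^ k *ℕ c) v ⟩
          (pow x (res z k) · pow x (2 ^ k *ℕ c)) v
            ≡⟨ ·-trivialBelow (pow x (res z k)) (pow-2^*-trivialBelow k x c) v ≤-refl ⟩
          pow x (res z k) v                           ∎
          where
          open ≡-Reasoning
          k = suc (length v)

        γ∈G : InG r s γ
        γ∈G L = xpow (+ res z L) , All.replicate⁺ (res z L) i-inRange , xpow-approx L

        φ-γ : φ (γ , γ∈G) ≈₂ z
        φ-γ n with res-≡+2^* z (n≤level n)
        ... | c , zM≡ = begin
          Φ n γ % 2 ^ n                       ≡⟨ mod⇒%-≡ Φ≡zM ⟩
          res z (level n) % 2 ^ n             ≡⟨ cong (_% 2 ^ n) zM≡ ⟩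
          (res z n +ℕ 2 ^ n *ℕ c) % 2 ^ n     ≡⟨ mod⇒%-≡ (+-multiple-mod (res z n) (2 ^ n) c) ⟩
          res z n % 2 ^ n                     ≡⟨ m<n⇒m%n≡m (res< z n) ⟩
          res z n                             ∎
          where
          instance _ = 2^≢0 n
          open ≡-Reasoning
          Φ≡zM : + Φ n γ ≡ + res z (level n) mod 2 ^ n
          Φ≡zM = subst (λ w → + Φ n γ ≡ w mod 2 ^ n) (weight-xpow (res z (level n)))
            (Φ-approx n (xpow (+ res z (level n))) (All.replicate⁺ (res z (level n)) i-inRange) (xpow-approx (level n)))

      φ-surjective : ∀ z → ∃ λ g → φ g ≈₂ z
      φ-surjective z = (Preimage.γ z , Preimage.γ∈G z) , Preimage.φ-γ z

      -- an element with vanishing coordinates is, on each finite level, a word ≡ x^{2ⁿc} modulo K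
      φ-kernel⊆N : ∀ g → IsZero (φ g) → InN r s i (proj₁ g)
      φ-kernel⊆N (γ , γ∈G) φγ≡0 n with γ∈G (n +ℕ level n)
      ... | u , vu , u≈γ with word-∼-xpow u vu
      ... | mk∼ m (ns , good , m≈ns) u≈mX = ns , good , (λ v l → begin
        ⟦ ns ⟧ₙ v                       ≡⟨ m≈ns v ⟨
        m v                             ≡⟨ identityʳ m v ⟨
        (m · idA) v                     ≡⟨ agree-· (agree-refl {p = m}) (xpow-trivialBelow n w≡0) v l ⟨
        (m · ⟦ xpow (weight i i′ u) ⟧) v ≡⟨ u≈mX v ⟨
        ⟦ u ⟧ v                          ≡⟨ u≈γ v (<-≤-trans l (m≤m+n n (level n))) ⟩
        γ v                              ∎)
        where
        open ≡-Reasoning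
        w≡0 : weight i i′ u ≡ 0ℤ mod 2 ^ n
        w≡0 = mod-trans (mod-sym (Φ-approx n u vu (agree-weaken (m≤n+m (level n) n) u≈γ)))
                        (%≡0⇒mod {{2^≢0 n}} (φγ≡0 n))

      nLetter-conj : ∀ h j e → evalLetter (nLetter (h , j , e)) ≈A (inv h · (letter (j , e) · h))
      nLetter-conj h j false = ·-assoc (inv h) (a j) h
      nLetter-conj h j true = ≈A-trans (inv-conj (a j) h) (·-assoc (inv h) (inv (a j)) h)

      -- replacing each conjugating h ∈ G by an approximating word gives a word of weight 0
      N-word-approx : ∀ M ns → Good ns → ∃ λ u → Valid u × AgreeBelow M ⟦ u ⟧ ⟦ ns ⟧ₙ × weight i i′ u ≡ 0ℤ
      N-word-approx M [] [] = [] , [] , agree-refl , refl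
      N-word-approx M ((h , j , e) ∷ ns) ((h∈G , rj , j≢i , j≢i′) ∷ good) with h∈G M | N-word-approx M ns good
      ... | uh , vuh , uh≈h | u , vu , u≈ns , wu≡0 =
        conj-word ++ u , All.++⁺ (All.++⁺ (valid-invW vuh) (rj ∷ vuh)) vu , approx , weight≡0
        where
        conj-word : GenWord
        conj-word = invW uh ++ (j , e) ∷ uh
        approx : AgreeBelow M ⟦ conj-word ++ u ⟧ ⟦ (h , j , e) ∷ ns ⟧ₙ
        approx v l = begin
          ⟦ conj-word ++ u ⟧ v
            ≡⟨ ⟦⟧-++ conj-word u v ⟩
          (⟦ conj-word ⟧ · ⟦ u ⟧) v
            ≡⟨ ·-congʳ ⟦ u ⟧ (⟦⟧-++ (invW uh) ((j , e) ∷ uh)) v ⟩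
          ((⟦ invW uh ⟧ · (letter (j , e) · ⟦ uh ⟧)) · ⟦ u ⟧) v
            ≡⟨ ·-congʳ ⟦ u ⟧ (·-congʳ (letter (j , e) · ⟦ uh ⟧) (⟦invW⟧ uh)) v ⟩
          ((inv ⟦ uh ⟧ · (letter (j , e) · ⟦ uh ⟧)) · ⟦ u ⟧) v
            ≡⟨ agree-· (agree-· (agree-inv uh≈h) (agree-· (agree-refl {p = letter (j , e)}) uh≈h)) u≈ns v l ⟩
          ((inv h · (letter (j , e) · h)) · ⟦ ns ⟧ₙ) v
            ≡⟨ ·-congʳ ⟦ ns ⟧ₙ (nLetter-conj h j e) v ⟨
          ⟦ (h , j , e) ∷ ns ⟧ₙ v ∎
          where open ≡-Reasoning
        weight≡0 : weight i i′ (conj-word ++ u) ≡ 0ℤ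
        weight≡0 rewrite weight-++ i i′ conj-word u | weight-++ i i′ (invW uh) ((j , e) ∷ uh)
                       | weight-invW i i′ uh | letterWeight-other {i} {i′} e j≢i j≢i′ | wu≡0 = cancel (weight i i′ uh)
          where cancel : ∀ w → (- w + (0ℤ + w)) + 0ℤ ≡ 0ℤ
                cancel = solve-∀

      N⊆φ-kernel : ∀ g → InN r s i (proj₁ g) → IsZero (φ g)
      N⊆φ-kernel (γ , _) γ∈N n with γ∈N (level n)
      ... | ns , good , ns≈γ with N-word-approx (level n) ns good
      ... | u , vu , u≈ns , wu≡0 = trans (mod⇒%-≡ Φ≡0) (m<n⇒m%n≡m (m^n>0 2 n))
        where
        instance _ = 2^≢0 n
        Φ≡0 : + Φ n γ ≡ + 0 mod 2 ^ n
        Φ≡0 = subst (λ w → + Φ n γ ≡ w mod 2 ^ n) wu≡0 (Φ-approx n u vu (agree-trans u≈ns ns≈γ))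

proposition6p3 : (r s : ℕ) → 3 ≤ r → 1 < s → s ≤ r →
    (i : ℕ) → 1 ≤ i → i ≤ r → QuotientIsoℤ₂ r s i
proposition6p3 r s _ 1<s s≤r i 1≤i i≤r =
  φ , φ-respects-≈ , φ-continuous , φ-homomorphism , φ-surjective , φ-kernel⊆N , N⊆φ-kernel
  where open Generators.Coordinates.Quotient r s 1<s s≤r i 1≤i i≤r
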